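{- Let $n\ge 2$, let $X$ be an $n$-colourable shift and let $w\in X$. Then for every $k\in\mathbb{N}$, $\psi(w_{[k,k+n)})=(-1)^k\,\psi(w_{[0,n)})$.
   Context: For a sequence $w=w_0w_1\dots$, $w_{[a,b)}=w_a\dots w_{b-1}$. For a finite string $w$ over $\{0,1\}$, $\#w$ is its length, $\varepsilon$ the empty string; for $\#w\ge1$, $l(w)$ is $w$ without its last letter and $r(w)$ is $w$ without its first letter. $T^n$ is the alternating string of length $n$ starting with $0$ ($T^0=\varepsilon$, $T^n=T^{n-1}0$ for odd $n$, $T^n=T^{n-1}1$ for even $n\ge2$) and $CT^n$ its letterwise complement. $\xi$: $\xi(\varepsilon)=0$; $\xi(w)=1$ if $w=T^k$, $k\ge2$ even; $\xi(w)=-1$ if $w=CT^k$, $k\ge2$ even; otherwise $\xi(w)=\operatorname{sgn}(\xi(l(w))+\xi(r(w)))$. $\phi$: $\phi(\varepsilon)=0$; $\phi(w)=-1$ if $w=0^k$, $k$ odd; $\phi(w)=1$ if $w=1^k$, $k$ odd; otherwise $\phi(w)=\operatorname{sgn}(\phi(r(w))-\phi(l(w)))$. $\psi(w)=\xi(w)^{\#w}\phi(w)$ (with $0^0=1$); $w$ is colourable iff $\psi(w)\ne0$. For $n\ge2$, the maximal $n$-colourable shift is the subshift of finite type in $\{0,1\}^{\mathbb{N}}$ consisting of all sequences none of whose length-$n$ factors is non-colourable; an $n$-colourable shift is any subshift of it. -}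

module Defs where

open import Data.Bool using (Bool; true; false; not; _∧_; if_then_else_)
import Data.Bool.Properties as BP
open import Data.Nat using (ℕ; zero; suc; _+_; _≤_)
open import Data.Integer using (ℤ; +_; -[1+_]; -1ℤ; 0ℤ; 1ℤ; -_) renaming (_+_ to _+ℤ_; _*_ to _*ℤ_)
open import Data.List using (List; []; _∷_; length; map; upTo; replicate; reverse)
open import Data.List.Properties using (≡-dec)
open import Relation.Nullary using (Dec; yes; no; does; ¬_)
open import Relation.Binary.PropositionalEquality using (_≡_)
open import Data.Product using (Σ; _×_)

isOdd : ℕ → Bool
isOdd zero = false
isOdd (suc n) = not (isOdd n)

isEven : ℕ → Bool
isEven n = not (isOdd n)

-- Letters: 0 = false, 1 = true.  Finite words are lists of Bool.
Word : Set
Word = List Bool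

Seq : Set
Seq = ℕ → Bool

factor : Seq → ℕ → ℕ → Word
factor w a len = map (λ i → w (a + i)) (upTo len)

l : Word → Word
l [] = []
l (x ∷ []) = []
l (x ∷ y ∷ ys) = x ∷ l (y ∷ ys)

r : Word → Word
r [] = []
r (x ∷ xs) = xs

T : ℕ → Word
T n = map (λ i → isOdd i) (upTo n)

CT : ℕ → Word
CT n = map not (T n)

_≟w_ : (u v : Word) → Dec (u ≡ v)
_≟w_ = ≡-dec BP._≟_

sgn : ℤ → ℤ
sgn (+ zero) = 0ℤ
sgn (+ suc _) = 1ℤ
sgn -[1+ _ ] = -1ℤ

isTeven : Word → Bool
isTeven w = does (w ≟w T (length w)) ∧ isEven (length w) ∧ does (2 Data.Nat.≤? length w)

isCTeven : Word → Bool
isCTeven w = does (w ≟w CT (length w)) ∧ isEven (length w) ∧ does (2 Data.Nat.≤? length w)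

isZeroOdd : Word → Bool
isZeroOdd w = does (w ≟w replicate (length w) false) ∧ isOdd (length w)

isOneOdd : Word → Bool
isOneOdd w = does (w ≟w replicate (length w) true) ∧ isOdd (length w)

-- ξ and φ, defined by recursion with fuel = #w (l and r shorten by one letter)
ξ-fuel : ℕ → Word → ℤ
ξ-fuel _ [] = 0ℤ
ξ-fuel zero (_ ∷ _) = 0ℤ   -- unreachable when fuel = length
ξ-fuel (suc f) w@(_ ∷ _) =
  if isTeven w then 1ℤ else
  if isCTeven w then -1ℤ else
  sgn (ξ-fuel f (l w) +ℤ ξ-fuel f (r w))

ξ : Word → ℤ
ξ w = ξ-fuel (length w) w

φ-fuel : ℕ → Word → ℤ
φ-fuel _ [] = 0ℤ
φ-fuel zero (_ ∷ _) = 0ℤ   -- unreachable when fuel = length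
φ-fuel (suc f) w@(_ ∷ _) =
  if isZeroOdd w then -1ℤ else
  if isOneOdd w then 1ℤ else
  sgn (φ-fuel f (r w) +ℤ (- φ-fuel f (l w)))

φ : Word → ℤ
φ w = φ-fuel (length w) w

-- ψ(w) = ξ(w)^{#w} φ(w)   (Data.Integer._^_ has x^0 = 1)
ψ : Word → ℤ
ψ w = (ξ w Data.Integer.^ length w) *ℤ φ w

Colourable : Word → Set
Colourable w = ¬ (ψ w ≡ 0ℤ)

σ : Seq → Seq
σ x i = x (suc i)

-- A subshift: shift-invariant and closed (in the product topology) set of sequences.
-- Closedness: x ∈ X whenever every prefix of x is a prefix of some point of X.
PrefixApprox : (Seq → Set) → Seq → ℕ → Set
PrefixApprox X x m = Σ Seq (λ y → X y × (factor y 0 m ≡ factor x 0 m))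

record IsSubshift (X : Seq → Set) : Set where
  field
    shift-invariant : ∀ x → X x → X (σ x)
    closed : ∀ x → (∀ m → PrefixApprox X x m) → X x

InMaxColShift : ℕ → Seq → Set
InMaxColShift n x = ∀ k → Colourable (factor x k n)

IsColourableShift : ℕ → (Seq → Set) → Set
IsColourableShift n X = IsSubshift X × (∀ x → X x → InMaxColShift n x)

-- ξ and φ are two instances of one recursion Ξ on lists of signs, which returns α on an
-- alternating run α, −α, α, … (α ≠ 0) of odd length and the sign of Ξ(init s) + Ξ(tail s)
-- otherwise: ξ(w) = Ξ(Δw) for the list Δw of jumps w_{i+1} − w_i, and φ(w) = ±Ξ of the signs
-- (−1)^i (2w_i − 1), the special words T^k, CT^k and 0^k, 1^k being exactly those whose list
-- is an odd run. The key property of Ξ is that stripping both ends of a list does not change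
-- its value unless what remains is an alternating run. For words this means that if the core A
-- of a window xAy is not 2-periodic then ψ(xAy) = −ψ(A): the length grows by two, which flips
-- the sign (−1)^{#w+1} in φ but not ξ^{#w}.
--
-- The theorem thus reduces to: the two windows x∷M and M∷y of any word have opposite ψ when
-- both are nonzero. If neither core is 2-periodic, the two ψ are minus those of the cores, and
-- the cores are the two windows of M, so induction applies. Otherwise one core is a long
-- 2-periodic block, which can be shortened by two without changing either ψ, because Ξ is
-- 2-periodic in the length of a long alternating or constant block. What remains are words of
-- length at most 7, which are checked exhaustively.

module Submission where

open import Defs
open import Data.Bool using (Bool; true; false; not; _∧_; if_then_else_)
open import Data.Bool.Properties using (not-involutive; ∧-zeroʳ) renaming (_≟_ to _≟ᵇ_)
open import Data.Empty using (⊥-elim)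
open import Data.Integer using (ℤ; 0ℤ; 1ℤ; -1ℤ; -_; _*_; _^_) renaming (_+_ to _+ℤ_; _≟_ to _≟ℤ_)
open import Data.Integer.Properties using (*-identityˡ; *-assoc; -1*i≡-i)
open import Data.List using (List; []; _∷_; _++_; _∷ʳ_; length; map; replicate; applyUpTo)
open import Data.List.Properties using (length-map; map-applyUpTo; map-upTo; applyUpTo-∷ʳ)
open import Data.Nat using (ℕ; zero; suc; _+_; _≤_; s≤s; z≤n; _≤?_)
open import Data.Nat.Properties using (≤-refl; +-identityʳ; +-suc; suc-injective)
open import Data.Product using (Σ-syntax; _×_; _,_; proj₂)
open import Data.Sum using (_⊎_; inj₁; inj₂)
open import Function using (_∘_)
open import Relation.Binary.Definitions using (DecidableEquality)
open import Relation.Binary.PropositionalEquality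
  using (_≡_; refl; sym; trans; cong; cong₂; subst; subst₂; module ≡-Reasoning)
open import Relation.Nullary using (Dec; yes; no; does; ¬_; ¬?)
open import Relation.Nullary.Decidable using (from-yes; map′; _×-dec_; _→-dec_; dec-true)

data Sgn : Set where
  neg nul pos : Sgn

⟦_⟧ : Sgn → ℤ
⟦ neg ⟧ = -1ℤ
⟦ nul ⟧ = 0ℤ
⟦ pos ⟧ = 1ℤ

negate : Sgn → Sgn
negate neg = pos
negate nul = nul
negate pos = neg

infixl 6 _⊕_
infixl 7 _⊗_

_⊕_ : Sgn → Sgn → Sgn
nul ⊕ b   = b
neg ⊕ nul = neg
neg ⊕ neg = neg
neg ⊕ pos = nul
pos ⊕ nul = pos
pos ⊕ neg = nul
pos ⊕ pos = pos

_⊗_ : Sgn → Sgn → Sgn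
neg ⊗ b = negate b
nul ⊗ b = nul
pos ⊗ b = b

_^ₛ_ : Sgn → ℕ → Sgn
a ^ₛ zero  = pos
a ^ₛ suc n = a ⊗ a ^ₛ n

isNul : Sgn → Bool
isNul nul = true
isNul _   = false

isNonzero : Sgn → Bool
isNonzero a = not (isNul a)

infix 4 _≟ₛ_
_≟ₛ_ : DecidableEquality Sgn
neg ≟ₛ neg = yes refl
nul ≟ₛ nul = yes refl
pos ≟ₛ pos = yes refl
neg ≟ₛ nul = no λ ()
neg ≟ₛ pos = no λ ()
nul ≟ₛ neg = no λ ()
nul ≟ₛ pos = no λ ()
pos ≟ₛ neg = no λ ()
pos ≟ₛ nul = no λ ()

∀Sgn? : {P : Sgn → Set} → (∀ a → Dec (P a)) → Dec (∀ a → P a)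
∀Sgn? P? = map′ (λ { (p , q , r) → λ { neg → p ; nul → q ; pos → r } })
                (λ f → f neg , f nul , f pos)
                (P? neg ×-dec P? nul ×-dec P? pos)

∀Bool? : {P : Bool → Set} → (∀ b → Dec (P b)) → Dec (∀ b → P b)
∀Bool? P? = map′ (λ { (p , q) → λ { false → p ; true → q } })
                 (λ f → f false , f true)
                 (P? false ×-dec P? true)

negate-involutive : ∀ a → negate (negate a) ≡ a
negate-involutive neg = refl
negate-involutive nul = refl
negate-involutive pos = refl

negate-⊕ : ∀ a b → negate (a ⊕ b) ≡ negate a ⊕ negate b
negate-⊕ = from-yes (∀Sgn? λ a → ∀Sgn? λ b → negate (a ⊕ b) ≟ₛ negate a ⊕ negate b)

isNul-negate : ∀ a → isNul (negate a) ≡ isNul a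
isNul-negate neg = refl
isNul-negate nul = refl
isNul-negate pos = refl

negate-if : ∀ c (a b : Sgn) → negate (if c then a else b) ≡ (if c then negate a else negate b)
negate-if true  a b = refl
negate-if false a b = refl

isNul-⊕ : ∀ a b → isNul (a ⊕ b) ≡ true → b ≡ negate a
isNul-⊕ = from-yes (∀Sgn? λ a → ∀Sgn? λ b → isNul (a ⊕ b) ≟ᵇ true →-dec b ≟ₛ negate a)

^ₛ-3+ : ∀ a n → a ^ₛ (3 + n) ≡ a ^ₛ (1 + n)
^ₛ-3+ neg n = negate-involutive (negate (neg ^ₛ n))
^ₛ-3+ nul n = refl
^ₛ-3+ pos n = refl

⊗-negateʳ : ∀ a x → a ⊗ negate x ≡ negate (a ⊗ x)
⊗-negateʳ neg x = refl
⊗-negateʳ nul x = refl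
⊗-negateʳ pos x = refl

⟦⊕⟧ : ∀ a b → sgn (⟦ a ⟧ +ℤ ⟦ b ⟧) ≡ ⟦ a ⊕ b ⟧
⟦⊕⟧ = from-yes (∀Sgn? λ a → ∀Sgn? λ b → sgn (⟦ a ⟧ +ℤ ⟦ b ⟧) ≟ℤ ⟦ a ⊕ b ⟧)

⟦⊖⟧ : ∀ a b → sgn (⟦ a ⟧ +ℤ - ⟦ b ⟧) ≡ ⟦ a ⊕ negate b ⟧
⟦⊖⟧ = from-yes (∀Sgn? λ a → ∀Sgn? λ b → sgn (⟦ a ⟧ +ℤ - ⟦ b ⟧) ≟ℤ ⟦ a ⊕ negate b ⟧)

⟦⊗⟧ : ∀ a b → ⟦ a ⊗ b ⟧ ≡ ⟦ a ⟧ * ⟦ b ⟧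
⟦⊗⟧ = from-yes (∀Sgn? λ a → ∀Sgn? λ b → ⟦ a ⊗ b ⟧ ≟ℤ ⟦ a ⟧ * ⟦ b ⟧)

⟦negate⟧ : ∀ a → ⟦ negate a ⟧ ≡ - ⟦ a ⟧
⟦negate⟧ = from-yes (∀Sgn? λ a → ⟦ negate a ⟧ ≟ℤ - ⟦ a ⟧)

⟦^ₛ⟧ : ∀ a n → ⟦ a ^ₛ n ⟧ ≡ ⟦ a ⟧ ^ n
⟦^ₛ⟧ a zero    = refl
⟦^ₛ⟧ a (suc n) = trans (⟦⊗⟧ a (a ^ₛ n)) (cong (⟦ a ⟧ *_) (⟦^ₛ⟧ a n))

isOdd-2+ : ∀ n → isOdd (2 + n) ≡ isOdd n
isOdd-2+ n = not-involutive (isOdd n)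

isEven-suc : ∀ n → isEven (suc n) ≡ isOdd n
isEven-suc n = not-involutive (isOdd n)

does≡true⇒ : ∀ {P : Set} (d : Dec P) → does d ≡ true → P
does≡true⇒ (yes p) _ = p

∧≡true⇒ : ∀ {p q} → p ∧ q ≡ true → p ≡ true × q ≡ true
∧≡true⇒ {true} q≡ = refl , q≡

contraposeᵇ : ∀ {p q} → (p ≡ true → q ≡ true) → q ≡ false → p ≡ false
contraposeᵇ {false} _ _ = refl
contraposeᵇ {true}  f e = trans (sym (f refl)) e

init : {A : Set} → List A → List A
init []           = []
init (x ∷ [])     = []
init (x ∷ y ∷ xs) = x ∷ init (y ∷ xs)

tail : {A : Set} → List A → List A
tail []       = []
tail (_ ∷ xs) = xs

length-init : {A : Set} (x : A) (xs : List A) → length (init (x ∷ xs)) ≡ length xs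
length-init x []       = refl
length-init x (y ∷ xs) = cong suc (length-init y xs)

init-∷ʳ : {A : Set} (xs : List A) (y : A) → init (xs ∷ʳ y) ≡ xs
init-∷ʳ []           y = refl
init-∷ʳ (x ∷ [])     y = refl
init-∷ʳ (x ∷ x′ ∷ xs) y = cong (x ∷_) (init-∷ʳ (x′ ∷ xs) y)

last : {A : Set} → A → List A → A
last x []       = x
last x (y ∷ xs) = last y xs

∷-init-last : {A : Set} (x : A) (xs : List A) → x ∷ xs ≡ init (x ∷ xs) ∷ʳ last x xs
∷-init-last x []       = refl
∷-init-last x (y ∷ xs) = cong (x ∷_) (∷-init-last y xs)

last-∷ʳ : {A : Set} (x : A) (xs : List A) (y : A) → last x (xs ∷ʳ y) ≡ y
last-∷ʳ x []       y = refl
last-∷ʳ x (x′ ∷ xs) y = last-∷ʳ x′ xs y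

length-∷ʳ : {A : Set} (xs : List A) (y : A) → length (xs ∷ʳ y) ≡ suc (length xs)
length-∷ʳ []       y = refl
length-∷ʳ (x ∷ xs) y = cong suc (length-∷ʳ xs y)

length-skip : {A : Set} (p : List A) (a b : A) (s : List A) → length (p ++ a ∷ b ∷ s) ≡ 2 + length (p ++ s)
length-skip []      a b s = refl
length-skip (x ∷ p) a b s = cong suc (length-skip p a b s)

init-map : {A B : Set} (f : A → B) (xs : List A) → init (map f xs) ≡ map f (init xs)
init-map f []           = refl
init-map f (x ∷ [])     = refl
init-map f (x ∷ y ∷ xs) = cong (f x ∷_) (init-map f (y ∷ xs))

alternate : {A : Set} → A → A → ℕ → List A
alternate a b zero    = []
alternate a b (suc n) = a ∷ alternate b a n

init-alternate : {A : Set} (a b : A) (n : ℕ) → init (alternate a b (suc n)) ≡ alternate a b n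
init-alternate a b zero    = refl
init-alternate a b (suc n) = cong (a ∷_) (init-alternate b a n)

length-alternate : {A : Set} (a b : A) (n : ℕ) → length (alternate a b n) ≡ n
length-alternate a b zero    = refl
length-alternate a b (suc n) = cong suc (length-alternate b a n)

map-alternate : {A B : Set} (f : A → B) (a b : A) (n : ℕ) → map f (alternate a b n) ≡ alternate (f a) (f b) n
map-alternate f a b zero    = refl
map-alternate f a b (suc n) = cong (f a ∷_) (map-alternate f b a n)

alternate-∷ʳ : {A : Set} (c : A) (n : ℕ) → alternate c c (suc n) ≡ alternate c c n ∷ʳ c
alternate-∷ʳ c zero    = refl
alternate-∷ʳ c (suc n) = cong (c ∷_) (alternate-∷ʳ c n)

alternate-diag : {A : Set} (a : A) (n : ℕ) → alternate a a n ≡ replicate n a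
alternate-diag a zero    = refl
alternate-diag a (suc n) = cong (a ∷_) (alternate-diag a n)

-- The sign recursion Ξ

zigzag : Sgn → ℕ → List Sgn
zigzag α = alternate α (negate α)

alternates : List Sgn → Bool
alternates (a ∷ b ∷ s) = isNul (a ⊕ b) ∧ alternates (b ∷ s)
alternates _           = true

oddRun : List Sgn → Bool
oddRun []      = false
oddRun (a ∷ s) = isNonzero a ∧ alternates (a ∷ s) ∧ isEven (length s)

Ξ-fuel : ℕ → List Sgn → Sgn
Ξ-fuel _       []      = nul
Ξ-fuel zero    (_ ∷ _) = nul
Ξ-fuel (suc f) (a ∷ s) =
  if oddRun (a ∷ s) then a else Ξ-fuel f (init (a ∷ s)) ⊕ Ξ-fuel f s

Ξ : List Sgn → Sgn
Ξ s = Ξ-fuel (length s) s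

Ξ-∷ : ∀ a s → Ξ (a ∷ s) ≡ (if oddRun (a ∷ s) then a else Ξ (init (a ∷ s)) ⊕ Ξ s)
Ξ-∷ a s rewrite length-init a s = refl

Ξ-cong-∷ : ∀ a s t → oddRun (a ∷ s) ≡ oddRun (a ∷ t) →
           Ξ (init (a ∷ s)) ≡ Ξ (init (a ∷ t)) → Ξ s ≡ Ξ t → Ξ (a ∷ s) ≡ Ξ (a ∷ t)
Ξ-cong-∷ a s t r i e = begin
  Ξ (a ∷ s)                                                   ≡⟨ Ξ-∷ a s ⟩
  (if oddRun (a ∷ s) then a else Ξ (init (a ∷ s)) ⊕ Ξ s)     ≡⟨ cong₂ (λ c v → if c then a else v) r (cong₂ _⊕_ i e) ⟩
  (if oddRun (a ∷ t) then a else Ξ (init (a ∷ t)) ⊕ Ξ t)     ≡⟨ sym (Ξ-∷ a t) ⟩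
  Ξ (a ∷ t)                                                   ∎
  where open ≡-Reasoning

Ξ-split : ∀ s → oddRun s ≡ false → Ξ s ≡ Ξ (init s) ⊕ Ξ (tail s)
Ξ-split []      _ = refl
Ξ-split (a ∷ s) r rewrite Ξ-∷ a s | r = refl

alternates-negate : ∀ s → alternates (map negate s) ≡ alternates s
alternates-negate []          = refl
alternates-negate (a ∷ [])    = refl
alternates-negate (a ∷ b ∷ s) =
  cong₂ _∧_ (trans (cong isNul (sym (negate-⊕ a b))) (isNul-negate (a ⊕ b))) (alternates-negate (b ∷ s))

oddRun-negate : ∀ s → oddRun (map negate s) ≡ oddRun s
oddRun-negate []      = refl
oddRun-negate (a ∷ s) = cong₂ _∧_ (cong not (isNul-negate a))
  (cong₂ _∧_ (alternates-negate (a ∷ s)) (cong isEven (length-map negate s)))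

Ξ-fuel-negate : ∀ f s → Ξ-fuel f (map negate s) ≡ negate (Ξ-fuel f s)
Ξ-fuel-negate _       []      = refl
Ξ-fuel-negate zero    (a ∷ s) = refl
Ξ-fuel-negate (suc f) (a ∷ s)
  rewrite oddRun-negate (a ∷ s) | init-map negate (a ∷ s)
        | Ξ-fuel-negate f (init (a ∷ s)) | Ξ-fuel-negate f s
        | negate-if (oddRun (a ∷ s)) a (Ξ-fuel f (init (a ∷ s)) ⊕ Ξ-fuel f s)
        | negate-⊕ (Ξ-fuel f (init (a ∷ s))) (Ξ-fuel f s) = refl

Ξ-negate : ∀ s → Ξ (map negate s) ≡ negate (Ξ s)
Ξ-negate s rewrite length-map negate s = Ξ-fuel-negate (length s) s

alternates-zigzag : ∀ α n → alternates (zigzag α n) ≡ true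
alternates-zigzag α   zero          = refl
alternates-zigzag α   (suc zero)    = refl
alternates-zigzag neg (suc (suc n)) = alternates-zigzag pos (suc n)
alternates-zigzag nul (suc (suc n)) = alternates-zigzag nul (suc n)
alternates-zigzag pos (suc (suc n)) = alternates-zigzag neg (suc n)

alternate-negate : ∀ α k → alternate (negate α) α k ≡ zigzag (negate α) k
alternate-negate α k = cong (λ β → alternate (negate α) β k) (sym (negate-involutive α))

oddRun-zigzag : ∀ α k → oddRun (zigzag α (suc k)) ≡ isNonzero α ∧ isEven k
oddRun-zigzag α k
  rewrite alternates-zigzag α (suc k) | length-alternate (negate α) α k = refl

Ξ-zigzag : ∀ α k → Ξ (zigzag α k) ≡ (if isOdd k then α else nul)
Ξ-zigzag α zero    = refl
Ξ-zigzag α (suc k) = begin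
  Ξ (zigzag α (suc k))
    ≡⟨ Ξ-∷ α (alternate (negate α) α k) ⟩
  (if oddRun (zigzag α (suc k)) then α else Ξ (init (zigzag α (suc k))) ⊕ Ξ (alternate (negate α) α k))
    ≡⟨ cong₂ (λ c v → if c then α else v) (oddRun-zigzag α k) (cong₂ _⊕_
         (trans (cong Ξ (init-alternate α (negate α) k)) (Ξ-zigzag α k))
         (trans (cong Ξ (alternate-negate α k)) (Ξ-zigzag (negate α) k))) ⟩
  (if isNonzero α ∧ isEven k then α
   else (if isOdd k then α else nul) ⊕ (if isOdd k then negate α else nul))
    ≡⟨ step α (isOdd k) ⟩
  (if isOdd (suc k) then α else nul) ∎
  where
  open ≡-Reasoning
  step : ∀ α b → (if isNonzero α ∧ not b then α
                  else (if b then α else nul) ⊕ (if b then negate α else nul))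
                 ≡ (if not b then α else nul)
  step = from-yes (∀Sgn? λ α → ∀Bool? λ b →
    (if isNonzero α ∧ not b then α else (if b then α else nul) ⊕ (if b then negate α else nul))
      ≟ₛ (if not b then α else nul))

Ξ-zigzag-period : ∀ α k → Ξ (zigzag α (2 + k)) ≡ Ξ (zigzag α k)
Ξ-zigzag-period α k rewrite Ξ-zigzag α (2 + k) | Ξ-zigzag α k | isOdd-2+ k = refl

alternates-∷-false : ∀ x s → alternates s ≡ false → alternates (x ∷ s) ≡ false
alternates-∷-false x (b ∷ s) h rewrite h = ∧-zeroʳ (isNul (x ⊕ b))

alternates-∷ʳ-false : ∀ s y → alternates s ≡ false → alternates (s ∷ʳ y) ≡ false
alternates-∷ʳ-false (a ∷ b ∷ s) y = ∧-false (isNul (a ⊕ b)) (alternates-∷ʳ-false (b ∷ s) y)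
  where
  ∧-false : ∀ p {q r} → (q ≡ false → r ≡ false) → p ∧ q ≡ false → p ∧ r ≡ false
  ∧-false false _ _ = refl
  ∧-false true  f h = f h

oddRun-false : ∀ s → alternates s ≡ false → oddRun s ≡ false
oddRun-false []      h = refl
oddRun-false (a ∷ s) h rewrite h = ∧-zeroʳ (isNonzero a)

alternates⇒zigzag : ∀ a s → alternates (a ∷ s) ≡ true → a ∷ s ≡ zigzag a (suc (length s))
alternates⇒zigzag a []      h = refl
alternates⇒zigzag a (b ∷ s) h with isNul (a ⊕ b) in e
... | true = cong (a ∷_) (begin
  b ∷ s                               ≡⟨ alternates⇒zigzag b s h ⟩
  zigzag b (suc (length s))           ≡⟨ cong (λ c → zigzag c (suc (length s))) (isNul-⊕ a b e) ⟩
  zigzag (negate a) (suc (length s))  ≡⟨ alternate-negate a (suc (length s)) ⟨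
  alternate (negate a) a (suc (length s)) ∎)
  where open ≡-Reasoning

-- Ξ is 2-periodic in the length of a long alternating block

alternates-skip : ∀ p α s → alternates (p ++ α ∷ negate α ∷ α ∷ s) ≡ alternates (p ++ α ∷ s)
alternates-skip []          neg s = refl
alternates-skip []          nul s = refl
alternates-skip []          pos s = refl
alternates-skip (x ∷ [])    α   s = cong (isNul (x ⊕ α) ∧_) (alternates-skip [] α s)
alternates-skip (x ∷ y ∷ p) α   s = cong (isNul (x ⊕ y) ∧_) (alternates-skip (y ∷ p) α s)

oddRun-skip : ∀ p α s → oddRun (p ++ α ∷ negate α ∷ α ∷ s) ≡ oddRun (p ++ α ∷ s)
oddRun-skip [] α s = cong (isNonzero α ∧_) (cong₂ _∧_ (alternates-skip [] α s) (cong not (isOdd-2+ (length s))))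
oddRun-skip (x ∷ p) α s = cong (isNonzero x ∧_) (cong₂ _∧_ (alternates-skip (x ∷ p) α s)
  (cong not (trans (cong isOdd (length-skip p α (negate α) (α ∷ s))) (isOdd-2+ (length (p ++ α ∷ s))))))

Ξ-skip : ∀ p α s → Ξ (init (p ++ α ∷ negate α ∷ α ∷ s)) ≡ Ξ (init (p ++ α ∷ s)) →
         Ξ (tail (p ++ α ∷ negate α ∷ α ∷ s)) ≡ Ξ (tail (p ++ α ∷ s)) →
         Ξ (p ++ α ∷ negate α ∷ α ∷ s) ≡ Ξ (p ++ α ∷ s)
Ξ-skip []      α s = Ξ-cong-∷ α (negate α ∷ α ∷ s) s (oddRun-skip [] α s)
Ξ-skip (x ∷ p) α s = Ξ-cong-∷ x (p ++ α ∷ negate α ∷ α ∷ s) (p ++ α ∷ s) (oddRun-skip (x ∷ p) α s)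

Ξ-∷zigzag-period : ∀ x α k → Ξ (x ∷ zigzag α (3 + k)) ≡ Ξ (x ∷ zigzag α (1 + k))
Ξ-∷zigzag-period x α zero = from-yes (∀Sgn? λ x → ∀Sgn? λ α →
  Ξ (x ∷ zigzag α 3) ≟ₛ Ξ (x ∷ zigzag α 1)) x α
Ξ-∷zigzag-period x α (suc k) =
  Ξ-skip (x ∷ []) α (alternate (negate α) α (suc k))
    (begin
      Ξ (x ∷ init (zigzag α (4 + k))) ≡⟨ cong (λ s → Ξ (x ∷ s)) (init-alternate α (negate α) (3 + k)) ⟩
      Ξ (x ∷ zigzag α (3 + k))        ≡⟨ Ξ-∷zigzag-period x α k ⟩
      Ξ (x ∷ zigzag α (1 + k))        ≡⟨ cong (λ s → Ξ (x ∷ s)) (init-alternate α (negate α) (1 + k)) ⟨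
      Ξ (x ∷ init (zigzag α (2 + k))) ∎)
    (Ξ-zigzag-period α (2 + k))
  where open ≡-Reasoning

Ξ-zigzag∷ʳ-period : ∀ α k y → Ξ (zigzag α (3 + k) ∷ʳ y) ≡ Ξ (zigzag α (1 + k) ∷ʳ y)
Ξ-zigzag∷ʳ-period α zero y = from-yes (∀Sgn? λ α → ∀Sgn? λ y →
  Ξ (zigzag α 3 ∷ʳ y) ≟ₛ Ξ (zigzag α 1 ∷ʳ y)) α y
Ξ-zigzag∷ʳ-period α (suc k) y =
  Ξ-skip [] α (alternate (negate α) α (suc k) ∷ʳ y)
    (begin
      Ξ (init (zigzag α (4 + k) ∷ʳ y)) ≡⟨ cong Ξ (init-∷ʳ (zigzag α (4 + k)) y) ⟩
      Ξ (zigzag α (4 + k))             ≡⟨ Ξ-zigzag-period α (2 + k) ⟩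
      Ξ (zigzag α (2 + k))             ≡⟨ cong Ξ (init-∷ʳ (zigzag α (2 + k)) y) ⟨
      Ξ (init (zigzag α (2 + k) ∷ʳ y)) ∎)
    (begin
      Ξ (alternate (negate α) α (3 + k) ∷ʳ y) ≡⟨ cong (λ s → Ξ (s ∷ʳ y)) (alternate-negate α (3 + k)) ⟩
      Ξ (zigzag (negate α) (3 + k) ∷ʳ y)      ≡⟨ Ξ-zigzag∷ʳ-period (negate α) k y ⟩
      Ξ (zigzag (negate α) (1 + k) ∷ʳ y)      ≡⟨ cong (λ s → Ξ (s ∷ʳ y)) (alternate-negate α (1 + k)) ⟨
      Ξ (alternate (negate α) α (1 + k) ∷ʳ y) ∎)
  where open ≡-Reasoning

Ξ-∷zigzag∷ʳ-period : ∀ x α k y → Ξ (x ∷ zigzag α (3 + k) ∷ʳ y) ≡ Ξ (x ∷ zigzag α (1 + k) ∷ʳ y)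
Ξ-∷zigzag∷ʳ-period x α k y =
  Ξ-skip (x ∷ []) α (alternate (negate α) α k ∷ʳ y)
    (begin
      Ξ (x ∷ init (zigzag α (3 + k) ∷ʳ y)) ≡⟨ cong (λ s → Ξ (x ∷ s)) (init-∷ʳ (zigzag α (3 + k)) y) ⟩
      Ξ (x ∷ zigzag α (3 + k))             ≡⟨ Ξ-∷zigzag-period x α k ⟩
      Ξ (x ∷ zigzag α (1 + k))             ≡⟨ cong (λ s → Ξ (x ∷ s)) (init-∷ʳ (zigzag α (1 + k)) y) ⟨
      Ξ (x ∷ init (zigzag α (1 + k) ∷ʳ y)) ∎)
    (Ξ-zigzag∷ʳ-period α k y)
  where open ≡-Reasoning

Ξ-zigzag∷ʳ∷ʳ-period : ∀ α k y₁ y₂ → Ξ ((zigzag α (4 + k) ∷ʳ y₁) ∷ʳ y₂) ≡ Ξ ((zigzag α (2 + k) ∷ʳ y₁) ∷ʳ y₂)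
Ξ-zigzag∷ʳ∷ʳ-period α zero y₁ y₂ = from-yes (∀Sgn? λ α → ∀Sgn? λ y₁ → ∀Sgn? λ y₂ →
  Ξ ((zigzag α 4 ∷ʳ y₁) ∷ʳ y₂) ≟ₛ Ξ ((zigzag α 2 ∷ʳ y₁) ∷ʳ y₂)) α y₁ y₂
Ξ-zigzag∷ʳ∷ʳ-period α (suc k) y₁ y₂ =
  Ξ-skip [] α ((alternate (negate α) α (2 + k) ∷ʳ y₁) ∷ʳ y₂)
    (begin
      Ξ (init ((zigzag α (5 + k) ∷ʳ y₁) ∷ʳ y₂)) ≡⟨ cong Ξ (init-∷ʳ (zigzag α (5 + k) ∷ʳ y₁) y₂) ⟩
      Ξ (zigzag α (5 + k) ∷ʳ y₁)                ≡⟨ Ξ-zigzag∷ʳ-period α (2 + k) y₁ ⟩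
      Ξ (zigzag α (3 + k) ∷ʳ y₁)                ≡⟨ cong Ξ (init-∷ʳ (zigzag α (3 + k) ∷ʳ y₁) y₂) ⟨
      Ξ (init ((zigzag α (3 + k) ∷ʳ y₁) ∷ʳ y₂)) ∎)
    (begin
      Ξ ((alternate (negate α) α (4 + k) ∷ʳ y₁) ∷ʳ y₂) ≡⟨ cong (λ s → Ξ ((s ∷ʳ y₁) ∷ʳ y₂)) (alternate-negate α (4 + k)) ⟩
      Ξ ((zigzag (negate α) (4 + k) ∷ʳ y₁) ∷ʳ y₂)      ≡⟨ Ξ-zigzag∷ʳ∷ʳ-period (negate α) k y₁ y₂ ⟩
      Ξ ((zigzag (negate α) (2 + k) ∷ʳ y₁) ∷ʳ y₂)      ≡⟨ cong (λ s → Ξ ((s ∷ʳ y₁) ∷ʳ y₂)) (alternate-negate α (2 + k)) ⟨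
      Ξ ((alternate (negate α) α (2 + k) ∷ʳ y₁) ∷ʳ y₂) ∎)
  where open ≡-Reasoning

Ξ-∷∷zigzag-period : ∀ x₁ x₂ α k → Ξ (x₁ ∷ x₂ ∷ zigzag α (4 + k)) ≡ Ξ (x₁ ∷ x₂ ∷ zigzag α (2 + k))
Ξ-∷∷zigzag-period x₁ x₂ α zero = from-yes (∀Sgn? λ x₁ → ∀Sgn? λ x₂ → ∀Sgn? λ α →
  Ξ (x₁ ∷ x₂ ∷ zigzag α 4) ≟ₛ Ξ (x₁ ∷ x₂ ∷ zigzag α 2)) x₁ x₂ α
Ξ-∷∷zigzag-period x₁ x₂ α (suc k) =
  Ξ-skip (x₁ ∷ x₂ ∷ []) α (alternate (negate α) α (2 + k))
    (begin
      Ξ (x₁ ∷ x₂ ∷ init (zigzag α (5 + k))) ≡⟨ cong (λ s → Ξ (x₁ ∷ x₂ ∷ s)) (init-alternate α (negate α) (4 + k)) ⟩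
      Ξ (x₁ ∷ x₂ ∷ zigzag α (4 + k))        ≡⟨ Ξ-∷∷zigzag-period x₁ x₂ α k ⟩
      Ξ (x₁ ∷ x₂ ∷ zigzag α (2 + k))        ≡⟨ cong (λ s → Ξ (x₁ ∷ x₂ ∷ s)) (init-alternate α (negate α) (2 + k)) ⟨
      Ξ (x₁ ∷ x₂ ∷ init (zigzag α (3 + k))) ∎)
    (Ξ-∷zigzag-period x₂ α (2 + k))
  where open ≡-Reasoning

-- Stripping the ends of a non-alternating list

Ξ-split-ends : ∀ x m y → alternates m ≡ false → Ξ (x ∷ m ∷ʳ y) ≡ Ξ (x ∷ m) ⊕ Ξ (m ∷ʳ y)
Ξ-split-ends x m y h =
  trans (Ξ-split (x ∷ m ∷ʳ y) (oddRun-false (x ∷ m ∷ʳ y) (alternates-∷-false x (m ∷ʳ y) (alternates-∷ʳ-false m y h))))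
        (cong (_⊕ Ξ (m ∷ʳ y)) (cong Ξ (init-∷ʳ (x ∷ m) y)))

Ξ-strip-pair : ∀ x a b y → alternates (a ∷ b ∷ []) ≡ false → Ξ (x ∷ a ∷ b ∷ y ∷ []) ≡ Ξ (a ∷ b ∷ [])
Ξ-strip-pair = from-yes (∀Sgn? λ x → ∀Sgn? λ a → ∀Sgn? λ b → ∀Sgn? λ y →
  alternates (a ∷ b ∷ []) ≟ᵇ false →-dec Ξ (x ∷ a ∷ b ∷ y ∷ []) ≟ₛ Ξ (a ∷ b ∷ []))

-- In the two cases where m is an alternating run with one more sign at an end, the claim becomes
-- an identity that is 2-periodic in the length of the run, so two instances of it decide it.
Ξ-strip-zigzag∷ʳ : ∀ x a i z y → alternates (zigzag a (2 + i) ∷ʳ z) ≡ false →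
                   Ξ (x ∷ (zigzag a (2 + i) ∷ʳ z) ∷ʳ y) ≡ Ξ (zigzag a (2 + i) ∷ʳ z)
Ξ-strip-zigzag∷ʳ x a i z y h = begin
  Ξ (x ∷ (zigzag a (2 + i) ∷ʳ z) ∷ʳ y)
    ≡⟨ Ξ-split-ends x (zigzag a (2 + i) ∷ʳ z) y h ⟩
  Ξ (x ∷ zigzag a (2 + i) ∷ʳ z) ⊕ Ξ ((zigzag a (2 + i) ∷ʳ z) ∷ʳ y)
    ≡⟨ identity i h ⟩
  Ξ (zigzag a (2 + i) ∷ʳ z) ∎
  where
  open ≡-Reasoning
  identity : ∀ i → alternates (zigzag a (2 + i) ∷ʳ z) ≡ false →
             Ξ (x ∷ zigzag a (2 + i) ∷ʳ z) ⊕ Ξ ((zigzag a (2 + i) ∷ʳ z) ∷ʳ y) ≡ Ξ (zigzag a (2 + i) ∷ʳ z)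
  identity zero = from-yes (∀Sgn? λ x → ∀Sgn? λ a → ∀Sgn? λ z → ∀Sgn? λ y →
    alternates (zigzag a 2 ∷ʳ z) ≟ᵇ false →-dec
    Ξ (x ∷ zigzag a 2 ∷ʳ z) ⊕ Ξ ((zigzag a 2 ∷ʳ z) ∷ʳ y) ≟ₛ Ξ (zigzag a 2 ∷ʳ z)) x a z y
  identity (suc zero) = from-yes (∀Sgn? λ x → ∀Sgn? λ a → ∀Sgn? λ z → ∀Sgn? λ y →
    alternates (zigzag a 3 ∷ʳ z) ≟ᵇ false →-dec
    Ξ (x ∷ zigzag a 3 ∷ʳ z) ⊕ Ξ ((zigzag a 3 ∷ʳ z) ∷ʳ y) ≟ₛ Ξ (zigzag a 3 ∷ʳ z)) x a z y
  identity (suc (suc i)) h = begin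
    Ξ (x ∷ zigzag a (4 + i) ∷ʳ z) ⊕ Ξ ((zigzag a (4 + i) ∷ʳ z) ∷ʳ y)
      ≡⟨ cong₂ _⊕_ (Ξ-∷zigzag∷ʳ-period x a (1 + i) z) (Ξ-zigzag∷ʳ∷ʳ-period a i z y) ⟩
    Ξ (x ∷ zigzag a (2 + i) ∷ʳ z) ⊕ Ξ ((zigzag a (2 + i) ∷ʳ z) ∷ʳ y)
      ≡⟨ identity i (trans (sym (alternates-skip [] a (alternate (negate a) a (suc i) ∷ʳ z))) h) ⟩
    Ξ (zigzag a (2 + i) ∷ʳ z)
      ≡⟨ Ξ-zigzag∷ʳ-period a (1 + i) z ⟨
    Ξ (zigzag a (4 + i) ∷ʳ z) ∎

Ξ-strip-∷zigzag : ∀ x a b i y → alternates (a ∷ zigzag b (2 + i)) ≡ false →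
                  Ξ (x ∷ (a ∷ zigzag b (2 + i)) ∷ʳ y) ≡ Ξ (a ∷ zigzag b (2 + i))
Ξ-strip-∷zigzag x a b i y h = trans (Ξ-split-ends x (a ∷ zigzag b (2 + i)) y h) (identity i h)
  where
  open ≡-Reasoning
  identity : ∀ i → alternates (a ∷ zigzag b (2 + i)) ≡ false →
             Ξ (x ∷ a ∷ zigzag b (2 + i)) ⊕ Ξ (a ∷ zigzag b (2 + i) ∷ʳ y) ≡ Ξ (a ∷ zigzag b (2 + i))
  identity zero = from-yes (∀Sgn? λ x → ∀Sgn? λ a → ∀Sgn? λ b → ∀Sgn? λ y →
    alternates (a ∷ zigzag b 2) ≟ᵇ false →-dec
    Ξ (x ∷ a ∷ zigzag b 2) ⊕ Ξ (a ∷ zigzag b 2 ∷ʳ y) ≟ₛ Ξ (a ∷ zigzag b 2)) x a b y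
  identity (suc zero) = from-yes (∀Sgn? λ x → ∀Sgn? λ a → ∀Sgn? λ b → ∀Sgn? λ y →
    alternates (a ∷ zigzag b 3) ≟ᵇ false →-dec
    Ξ (x ∷ a ∷ zigzag b 3) ⊕ Ξ (a ∷ zigzag b 3 ∷ʳ y) ≟ₛ Ξ (a ∷ zigzag b 3)) x a b y
  identity (suc (suc i)) h = begin
    Ξ (x ∷ a ∷ zigzag b (4 + i)) ⊕ Ξ (a ∷ zigzag b (4 + i) ∷ʳ y)
      ≡⟨ cong₂ _⊕_ (Ξ-∷∷zigzag-period x a b i) (Ξ-∷zigzag∷ʳ-period a b (1 + i) y) ⟩
    Ξ (x ∷ a ∷ zigzag b (2 + i)) ⊕ Ξ (a ∷ zigzag b (2 + i) ∷ʳ y)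
      ≡⟨ identity i (trans (sym (alternates-skip (a ∷ []) b (alternate (negate b) b (suc i)))) h) ⟩
    Ξ (a ∷ zigzag b (2 + i))
      ≡⟨ Ξ-∷zigzag-period a b (1 + i) ⟨
    Ξ (a ∷ zigzag b (4 + i)) ∎

Ξ-strip-initRun : ∀ x a b t y → alternates (a ∷ init (b ∷ t)) ≡ true → alternates (a ∷ b ∷ t) ≡ false →
                  Ξ (x ∷ (a ∷ b ∷ t) ∷ʳ y) ≡ Ξ (a ∷ b ∷ t)
Ξ-strip-initRun x a b []      y _ h = Ξ-strip-pair x a b y h
Ξ-strip-initRun x a b (c ∷ t) y r h = subst (λ m → Ξ (x ∷ m ∷ʳ y) ≡ Ξ m) (sym m≡)
  (Ξ-strip-zigzag∷ʳ x a (length t) (last b (c ∷ t)) y (subst (λ m → alternates m ≡ false) m≡ h))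
  where
  m≡ : a ∷ b ∷ c ∷ t ≡ zigzag a (2 + length t) ∷ʳ last b (c ∷ t)
  m≡ = trans (∷-init-last a (b ∷ c ∷ t))
             (cong (_∷ʳ last b (c ∷ t)) (trans (alternates⇒zigzag a (init (b ∷ c ∷ t)) r)
                                              (cong (λ k → zigzag a (suc k)) (length-init b (c ∷ t)))))

Ξ-strip-tailRun : ∀ x a b t y → alternates (a ∷ init (b ∷ t)) ≡ false → alternates (b ∷ t) ≡ true →
                  alternates (a ∷ b ∷ t) ≡ false → Ξ (x ∷ (a ∷ b ∷ t) ∷ʳ y) ≡ Ξ (a ∷ b ∷ t)
Ξ-strip-tailRun x a b (c ∷ t) y _ r h = subst (λ m → Ξ (x ∷ m ∷ʳ y) ≡ Ξ m) (sym m≡)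
  (Ξ-strip-∷zigzag x a b (length t) y (subst (λ m → alternates m ≡ false) m≡ h))
  where
  m≡ : a ∷ b ∷ c ∷ t ≡ a ∷ zigzag b (2 + length t)
  m≡ = cong (a ∷_) (alternates⇒zigzag b (c ∷ t) r)

Ξ-strip-bounded : ∀ n x m y → length m ≤ n → alternates m ≡ false → Ξ (x ∷ m ∷ʳ y) ≡ Ξ m
Ξ-strip-bounded (suc n) x (a ∷ b ∷ t) y (s≤s ∣m∣≤) h =
  cases (alternates (init m)) refl (alternates (tail m)) refl
  where
  m = a ∷ b ∷ t
  cases : ∀ p → alternates (init m) ≡ p → ∀ q → alternates (tail m) ≡ q → Ξ (x ∷ m ∷ʳ y) ≡ Ξ m
  cases true  initRun _     _       = Ξ-strip-initRun x a b t y initRun h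
  cases false initAlt true  tailRun = Ξ-strip-tailRun x a b t y initAlt tailRun h
  cases false initAlt false tailAlt = begin
    Ξ (x ∷ m ∷ʳ y)           ≡⟨ Ξ-split-ends x m y h ⟩
    Ξ (x ∷ m) ⊕ Ξ (m ∷ʳ y)   ≡⟨ cong₂ _⊕_ stripInit stripTail ⟩
    Ξ (init m) ⊕ Ξ (tail m)  ≡⟨ Ξ-split m (oddRun-false m h) ⟨
    Ξ m                      ∎
    where
    open ≡-Reasoning
    stripInit : Ξ (x ∷ m) ≡ Ξ (init m)
    stripInit = trans (cong (λ s → Ξ (x ∷ s)) (∷-init-last a (b ∷ t)))
      (Ξ-strip-bounded n x (init m) (last b t) (subst (_≤ n) (sym (length-init a (b ∷ t))) ∣m∣≤) initAlt)
    stripTail : Ξ (m ∷ʳ y) ≡ Ξ (tail m)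
    stripTail = Ξ-strip-bounded n a (b ∷ t) y ∣m∣≤ tailAlt

Ξ-strip : ∀ x m y → alternates m ≡ false → Ξ (x ∷ m ∷ʳ y) ≡ Ξ m
Ξ-strip x m y = Ξ-strip-bounded (length m) x m y ≤-refl

alternates-constant : ∀ c k → isNonzero c ≡ true → alternates (alternate c c (2 + k)) ≡ false
alternates-constant neg k _ = refl
alternates-constant pos k _ = refl

Ξ-constant : ∀ c n → Ξ (alternate c c (suc n)) ≡ c
Ξ-constant nul n = trans (Ξ-zigzag nul (suc n)) (if-same (isOdd (suc n)))
  where
  if-same : ∀ b → (if b then nul else nul) ≡ nul
  if-same true  = refl
  if-same false = refl
Ξ-constant neg zero    = refl
Ξ-constant pos zero    = refl
Ξ-constant neg (suc n) = trans (Ξ-split (alternate neg neg (2 + n)) refl)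
  (cong₂ _⊕_ (trans (cong Ξ (init-alternate neg neg (suc n))) (Ξ-constant neg n)) (Ξ-constant neg n))
Ξ-constant pos (suc n) = trans (Ξ-split (alternate pos pos (2 + n)) refl)
  (cong₂ _⊕_ (trans (cong Ξ (init-alternate pos pos (suc n))) (Ξ-constant pos n)) (Ξ-constant pos n))

Ξ-∷constant∷ʳ : ∀ x c k y → isNonzero c ≡ true → Ξ (x ∷ alternate c c (2 + k) ∷ʳ y) ≡ c
Ξ-∷constant∷ʳ x c k y nz = trans (Ξ-strip x (alternate c c (2 + k)) y (alternates-constant c k nz)) (Ξ-constant c (suc k))

Ξ-constant∷ʳ : ∀ c k y → isNonzero c ≡ true → Ξ (alternate c c (2 + k) ∷ʳ y) ≡ c
Ξ-constant∷ʳ c zero    = from-yes (∀Sgn? λ c → ∀Sgn? λ y →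
  isNonzero c ≟ᵇ true →-dec Ξ (alternate c c 2 ∷ʳ y) ≟ₛ c) c
Ξ-constant∷ʳ c (suc k) y nz = Ξ-∷constant∷ʳ c c k y nz

Ξ-∷constant : ∀ x c k → isNonzero c ≡ true → Ξ (x ∷ alternate c c (2 + k)) ≡ c
Ξ-∷constant x c zero    = from-yes (∀Sgn? λ x → ∀Sgn? λ c →
  isNonzero c ≟ᵇ true →-dec Ξ (x ∷ alternate c c 2) ≟ₛ c) x c
Ξ-∷constant x c (suc k) nz = begin
  Ξ (x ∷ alternate c c (3 + k))        ≡⟨ cong (λ s → Ξ (x ∷ s)) (alternate-∷ʳ c (2 + k)) ⟩
  Ξ (x ∷ alternate c c (2 + k) ∷ʳ c)   ≡⟨ Ξ-∷constant∷ʳ x c k c nz ⟩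
  c                                    ∎
  where open ≡-Reasoning

Ξ-constant∷ʳ∷ʳ : ∀ c k y₁ y₂ → isNonzero c ≡ true → Ξ ((alternate c c (3 + k) ∷ʳ y₁) ∷ʳ y₂) ≡ c
Ξ-constant∷ʳ∷ʳ c k y₁ y₂ nz = trans
  (Ξ-strip c (alternate c c (2 + k) ∷ʳ y₁) y₂ (alternates-∷ʳ-false (alternate c c (2 + k)) y₁ (alternates-constant c k nz)))
  (Ξ-constant∷ʳ c k y₁ nz)

Ξ-∷∷constant : ∀ x₁ x₂ c k → isNonzero c ≡ true → Ξ (x₁ ∷ x₂ ∷ alternate c c (3 + k)) ≡ c
Ξ-∷∷constant x₁ x₂ c k nz = begin
  Ξ (x₁ ∷ x₂ ∷ alternate c c (3 + k))        ≡⟨ cong (λ s → Ξ (x₁ ∷ x₂ ∷ s)) (alternate-∷ʳ c (2 + k)) ⟩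
  Ξ (x₁ ∷ (x₂ ∷ alternate c c (2 + k)) ∷ʳ c) ≡⟨ Ξ-strip x₁ (x₂ ∷ alternate c c (2 + k)) c
                                                  (alternates-∷-false x₂ (alternate c c (2 + k)) (alternates-constant c k nz)) ⟩
  Ξ (x₂ ∷ alternate c c (2 + k))             ≡⟨ Ξ-∷constant x₂ c k nz ⟩
  c                                          ∎
  where open ≡-Reasoning

-- The signs of a 2-periodic word abab… form a zigzag block if a = b and a constant block if a ≠ b.
data Block : Sgn → Sgn → Set where
  zigzag-block   : ∀ α → Block α (negate α)
  constant-block : ∀ c → isNonzero c ≡ true → Block c c

Ξ-∷block∷ʳ-period : ∀ {α β} → Block α β → ∀ x k y →
                    Ξ (x ∷ alternate α β (5 + k) ∷ʳ y) ≡ Ξ (x ∷ alternate α β (3 + k) ∷ʳ y)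
Ξ-∷block∷ʳ-period (zigzag-block α)      x k y = Ξ-∷zigzag∷ʳ-period x α (2 + k) y
Ξ-∷block∷ʳ-period (constant-block c nz) x k y =
  trans (Ξ-∷constant∷ʳ x c (3 + k) y nz) (sym (Ξ-∷constant∷ʳ x c (1 + k) y nz))

Ξ-block∷ʳ∷ʳ-period : ∀ {α β} → Block α β → ∀ k y₁ y₂ →
                     Ξ ((alternate α β (5 + k) ∷ʳ y₁) ∷ʳ y₂) ≡ Ξ ((alternate α β (3 + k) ∷ʳ y₁) ∷ʳ y₂)
Ξ-block∷ʳ∷ʳ-period (zigzag-block α)      k y₁ y₂ = Ξ-zigzag∷ʳ∷ʳ-period α (1 + k) y₁ y₂
Ξ-block∷ʳ∷ʳ-period (constant-block c nz) k y₁ y₂ =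
  trans (Ξ-constant∷ʳ∷ʳ c (2 + k) y₁ y₂ nz) (sym (Ξ-constant∷ʳ∷ʳ c k y₁ y₂ nz))

Ξ-∷∷block-period : ∀ {α β} → Block α β → ∀ x₁ x₂ k →
                   Ξ (x₁ ∷ x₂ ∷ alternate α β (5 + k)) ≡ Ξ (x₁ ∷ x₂ ∷ alternate α β (3 + k))
Ξ-∷∷block-period (zigzag-block α)      x₁ x₂ k = Ξ-∷∷zigzag-period x₁ x₂ α (1 + k)
Ξ-∷∷block-period (constant-block c nz) x₁ x₂ k =
  trans (Ξ-∷∷constant x₁ x₂ c (2 + k) nz) (sym (Ξ-∷∷constant x₁ x₂ c k nz))

letter : Bool → Sgn
letter false = neg
letter true  = pos

jump : Bool → Bool → Sgn
jump false true  = pos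
jump true  false = neg
jump _     _     = nul

Δ : Word → List Sgn
Δ (a ∷ b ∷ w) = jump a b ∷ Δ (b ∷ w)
Δ _           = []

negate^ : ℕ → Sgn → Sgn
negate^ n x = if isOdd n then negate x else x

signs : ℕ → Word → List Sgn
signs i []      = []
signs i (a ∷ w) = negate^ i (letter a) ∷ signs (suc i) w

Φ : Word → Sgn
Φ w = negate^ (suc (length w)) (Ξ (signs 0 w))

Ψ : Word → Sgn
Ψ w = Ξ (Δ w) ^ₛ length w ⊗ Φ w

jump-swap : ∀ a b → jump b a ≡ negate (jump a b)
jump-swap false false = refl
jump-swap false true  = refl
jump-swap true  false = refl
jump-swap true  true  = refl

Δ-∷ʳ : ∀ a w y → Δ ((a ∷ w) ∷ʳ y) ≡ Δ (a ∷ w) ∷ʳ jump (last a w) y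
Δ-∷ʳ a []      y = refl
Δ-∷ʳ a (b ∷ w) y = cong (jump a b ∷_) (Δ-∷ʳ b w y)

Δ-alternate : ∀ a b n → Δ (alternate a b (suc n)) ≡ zigzag (jump a b) n
Δ-alternate a b zero    = refl
Δ-alternate a b (suc n) = cong (jump a b ∷_) (begin
  Δ (alternate b a (suc n))                   ≡⟨ Δ-alternate b a n ⟩
  zigzag (jump b a) n                         ≡⟨ cong (λ j → zigzag j n) (jump-swap a b) ⟩
  zigzag (negate (jump a b)) n                ≡⟨ alternate-negate (jump a b) n ⟨
  alternate (negate (jump a b)) (jump a b) n  ∎)
  where open ≡-Reasoning

length-Δ : ∀ a w → length (Δ (a ∷ w)) ≡ length w
length-Δ a []      = refl
length-Δ a (b ∷ w) = cong suc (length-Δ b w)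

isNonzero-jump : ∀ a b → isNonzero (jump a b) ≡ true → b ≡ not a
isNonzero-jump false true  _ = refl
isNonzero-jump true  false _ = refl

Δ-l : ∀ w → Δ (l w) ≡ init (Δ w)
Δ-l []              = refl
Δ-l (a ∷ [])        = refl
Δ-l (a ∷ b ∷ [])    = refl
Δ-l (a ∷ b ∷ c ∷ w) = cong (jump a b ∷_) (Δ-l (b ∷ c ∷ w))

Δ-r : ∀ w → Δ (r w) ≡ tail (Δ w)
Δ-r []          = refl
Δ-r (a ∷ [])    = refl
Δ-r (a ∷ b ∷ w) = refl

length-l : ∀ a w → length (l (a ∷ w)) ≡ length w
length-l a []      = refl
length-l a (b ∷ w) = cong suc (length-l b w)

negate^-suc : ∀ n x → negate^ (suc n) x ≡ negate (negate^ n x)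
negate^-suc n x with isOdd n
... | true  = sym (negate-involutive x)
... | false = refl

negate^-2+ : ∀ n x → negate^ (2 + n) x ≡ negate^ n x
negate^-2+ n x = cong (λ b → if b then negate x else x) (isOdd-2+ n)

negate^-negate : ∀ n x → negate^ n (negate x) ≡ negate (negate^ n x)
negate^-negate n x with isOdd n
... | true  = refl
... | false = refl

signs-suc : ∀ i w → signs (suc i) w ≡ map negate (signs i w)
signs-suc i []      = refl
signs-suc i (a ∷ w) = cong₂ _∷_ (negate^-suc i (letter a)) (signs-suc (suc i) w)

signs-∷ʳ : ∀ i w y → signs i (w ∷ʳ y) ≡ signs i w ∷ʳ negate^ (i + length w) (letter y)
signs-∷ʳ i []      y = cong (λ j → negate^ j (letter y) ∷ []) (sym (+-identityʳ i))
signs-∷ʳ i (a ∷ w) y = cong (negate^ i (letter a) ∷_)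
  (trans (signs-∷ʳ (suc i) w y) (cong (λ j → signs (suc i) w ∷ʳ negate^ j (letter y)) (sym (+-suc i (length w)))))

signs-alternate : ∀ i a b n → signs i (alternate a b n) ≡ alternate (negate^ i (letter a)) (negate^ (suc i) (letter b)) n
signs-alternate i a b zero    = refl
signs-alternate i a b (suc n) = cong (negate^ i (letter a) ∷_) (trans (signs-alternate (suc i) b a n)
  (cong (λ c → alternate (negate^ (suc i) (letter b)) c n) (negate^-2+ i (letter a))))

length-signs : ∀ i w → length (signs i w) ≡ length w
length-signs i []      = refl
length-signs i (a ∷ w) = cong suc (length-signs (suc i) w)

signs-l : ∀ i w → signs i (l w) ≡ init (signs i w)
signs-l i []              = refl
signs-l i (a ∷ [])        = refl
signs-l i (a ∷ b ∷ w)     = cong (negate^ i (letter a) ∷_) (signs-l (suc i) (b ∷ w))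

isNonzero-negate^-letter : ∀ i a → isNonzero (negate^ i (letter a)) ≡ true
isNonzero-negate^-letter i a with isOdd i | a
... | true  | true  = refl
... | true  | false = refl
... | false | true  = refl
... | false | false = refl

negate^-letter-not : ∀ i a → negate^ (suc i) (letter (not a)) ≡ negate^ i (letter a)
negate^-letter-not i a rewrite negate^-suc i (letter (not a)) with isOdd i | a
... | true  | true  = refl
... | true  | false = refl
... | false | true  = refl
... | false | false = refl

signs-block : ∀ i a b → Block (negate^ i (letter a)) (negate^ (suc i) (letter b))
signs-block i false false = subst (Block (negate^ i neg)) (sym (negate^-suc i neg)) (zigzag-block _)
signs-block i true  true  = subst (Block (negate^ i pos)) (sym (negate^-suc i pos)) (zigzag-block _)
signs-block i false true  = subst (Block (negate^ i neg)) (sym (negate^-letter-not i false))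
                                  (constant-block _ (isNonzero-negate^-letter i false))
signs-block i true  false = subst (Block (negate^ i pos)) (sym (negate^-letter-not i true))
                                  (constant-block _ (isNonzero-negate^-letter i true))

isNul-signs-pair : ∀ i a b → isNul (negate^ i (letter a) ⊕ negate^ (suc i) (letter b)) ≡ true → b ≡ a
isNul-signs-pair i a b rewrite negate^-suc i (letter b) with isOdd i | a | b
... | true  | false | false = λ _ → refl
... | true  | true  | true  = λ _ → refl
... | false | false | false = λ _ → refl
... | false | true  | true  = λ _ → refl

alternates-signs⇒constant : ∀ i a w → alternates (signs i (a ∷ w)) ≡ true → a ∷ w ≡ alternate a a (suc (length w))
alternates-signs⇒constant i a []      _ = refl
alternates-signs⇒constant i a (b ∷ w) h with isNul (negate^ i (letter a) ⊕ negate^ (suc i) (letter b)) in e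
... | true with isNul-signs-pair i a b e
...   | refl = cong (a ∷_) (alternates-signs⇒constant (suc i) a w h)

alternates-signs⇒alternates-Δ : ∀ i w → alternates (signs i w) ≡ true → alternates (Δ w) ≡ true
alternates-signs⇒alternates-Δ i []      _ = refl
alternates-signs⇒alternates-Δ i (a ∷ w) h = begin
  alternates (Δ (a ∷ w))                           ≡⟨ cong (alternates ∘ Δ) (alternates-signs⇒constant i a w h) ⟩
  alternates (Δ (alternate a a (suc (length w))))  ≡⟨ cong alternates (Δ-alternate a a (length w)) ⟩
  alternates (zigzag (jump a a) (length w))        ≡⟨ alternates-zigzag (jump a a) (length w) ⟩
  true                                             ∎
  where open ≡-Reasoning

alternates-Δ⇒alternate : ∀ w → alternates (Δ w) ≡ true → Σ[ a ∈ Bool ] Σ[ b ∈ Bool ] w ≡ alternate a b (length w)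
alternates-Δ⇒alternate []          _ = false , false , refl
alternates-Δ⇒alternate (a ∷ [])    _ = a , a , refl
alternates-Δ⇒alternate (a ∷ b ∷ w) h = a , b , cong (a ∷_) (tail-alternates b a w h)
  where
  jumps-cancel : ∀ a b c → isNul (jump a b ⊕ jump b c) ≡ true → c ≡ a
  jumps-cancel false false false _ = refl
  jumps-cancel false true  false _ = refl
  jumps-cancel true  false true  _ = refl
  jumps-cancel true  true  true  _ = refl
  tail-alternates : ∀ b a w → alternates (Δ (a ∷ b ∷ w)) ≡ true → b ∷ w ≡ alternate b a (suc (length w))
  tail-alternates b a []      _ = refl
  tail-alternates b a (c ∷ w) h with isNul (jump a b ⊕ jump b c) in e
  ... | true with jumps-cancel a b c e
  ...   | refl = cong (b ∷_) (tail-alternates a b w h)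

T-alternate : ∀ n → T n ≡ alternate false true n
T-alternate zero    = refl
T-alternate (suc n) = cong (false ∷_) (begin
  map isOdd (applyUpTo suc n)       ≡⟨ map-applyUpTo suc isOdd n ⟩
  applyUpTo (not ∘ isOdd) n         ≡⟨ map-applyUpTo isOdd not n ⟨
  map not (applyUpTo isOdd n)       ≡⟨ cong (map not) (map-upTo isOdd n) ⟨
  map not (T n)                     ≡⟨ cong (map not) (T-alternate n) ⟩
  map not (alternate false true n)  ≡⟨ map-alternate not false true n ⟩
  alternate true false n            ∎)
  where open ≡-Reasoning

CT-alternate : ∀ n → CT n ≡ alternate true false n
CT-alternate n = trans (cong (map not) (T-alternate n)) (map-alternate not false true n)

Ξ-Δ-even-alternation : ∀ a w → w ≡ alternate a (not a) (length w) → isEven (length w) ≡ true → 2 ≤ length w →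
                       Ξ (Δ w) ≡ jump a (not a)
Ξ-Δ-even-alternation a w w≡ even two≤ = trans (cong (Ξ ∘ Δ) w≡) (go (length w) even two≤)
  where
  go : ∀ n → isEven n ≡ true → 2 ≤ n → Ξ (Δ (alternate a (not a) n)) ≡ jump a (not a)
  go (suc k) even _ = begin
    Ξ (Δ (alternate a (not a) (suc k)))        ≡⟨ cong Ξ (Δ-alternate a (not a) k) ⟩
    Ξ (zigzag (jump a (not a)) k)              ≡⟨ Ξ-zigzag (jump a (not a)) k ⟩
    (if isOdd k then jump a (not a) else nul)  ≡⟨ cong (λ b → if b then jump a (not a) else nul) (trans (sym (isEven-suc k)) even) ⟩
    jump a (not a)                             ∎
    where open ≡-Reasoning

isTeven⇒ΞΔ≡pos : ∀ w → isTeven w ≡ true → Ξ (Δ w) ≡ pos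
isTeven⇒ΞΔ≡pos w h with ∧≡true⇒ {does (w ≟w T (length w))} h
... | w≡T , h′ with ∧≡true⇒ {isEven (length w)} h′
... | even , two≤ = Ξ-Δ-even-alternation false w
  (trans (does≡true⇒ (w ≟w T (length w)) w≡T) (T-alternate (length w))) even (does≡true⇒ (2 ≤? length w) two≤)

isCTeven⇒ΞΔ≡neg : ∀ w → isCTeven w ≡ true → Ξ (Δ w) ≡ neg
isCTeven⇒ΞΔ≡neg w h with ∧≡true⇒ {does (w ≟w CT (length w))} h
... | w≡CT , h′ with ∧≡true⇒ {isEven (length w)} h′
... | even , two≤ = Ξ-Δ-even-alternation true w
  (trans (does≡true⇒ (w ≟w CT (length w)) w≡CT) (CT-alternate (length w))) even (does≡true⇒ (2 ≤? length w) two≤)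

oddRun-Δ⇒isTeven⊎isCTeven : ∀ w → oddRun (Δ w) ≡ true → isTeven w ≡ true ⊎ isCTeven w ≡ true
oddRun-Δ⇒isTeven⊎isCTeven (a ∷ b ∷ t) h with ∧≡true⇒ {isNonzero (jump a b)} h
... | nz , h′ with ∧≡true⇒ {alternates (Δ (a ∷ b ∷ t))} h′ | isNonzero-jump a b nz
... | periodic , even | refl = intro a w≡
  where
  w = a ∷ not a ∷ t
  n = length w
  w≡ : w ≡ alternate a (not a) n
  w≡ = proj₂ (proj₂ (alternates-Δ⇒alternate w periodic))
  even′ : isEven n ≡ true
  even′ = trans (cong not (isOdd-2+ (length t))) (trans (cong isEven (sym (length-Δ (not a) t))) even)
  two≤ : 2 ≤ n
  two≤ = s≤s (s≤s z≤n)
  intro : ∀ c → w ≡ alternate c (not c) n → isTeven w ≡ true ⊎ isCTeven w ≡ true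
  intro false w≡ rewrite dec-true (w ≟w T n) (trans w≡ (sym (T-alternate n))) | even′ | dec-true (2 ≤? n) two≤ = inj₁ refl
  intro true  w≡ rewrite dec-true (w ≟w CT n) (trans w≡ (sym (CT-alternate n))) | even′ | dec-true (2 ≤? n) two≤ = inj₂ refl

ξ-fuel-Δ : ∀ f w → length w ≤ f → ξ-fuel f w ≡ ⟦ Ξ (Δ w) ⟧
ξ-fuel-Δ zero    []      _ = refl
ξ-fuel-Δ (suc f) []      _ = refl
ξ-fuel-Δ (suc f) (a ∷ t) (s≤s ∣t∣≤) with isTeven (a ∷ t) in even | isCTeven (a ∷ t) in coeven
... | true  | _     = cong ⟦_⟧ (sym (isTeven⇒ΞΔ≡pos (a ∷ t) even))
... | false | true  = cong ⟦_⟧ (sym (isCTeven⇒ΞΔ≡neg (a ∷ t) coeven))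
... | false | false = begin
  sgn (ξ-fuel f (l w) +ℤ ξ-fuel f (r w))
    ≡⟨ cong₂ (λ p q → sgn (p +ℤ q)) (ξ-fuel-Δ f (l w) (subst (_≤ f) (sym (length-l a t)) ∣t∣≤)) (ξ-fuel-Δ f t ∣t∣≤) ⟩
  sgn (⟦ Ξ (Δ (l w)) ⟧ +ℤ ⟦ Ξ (Δ (r w)) ⟧)  ≡⟨ ⟦⊕⟧ (Ξ (Δ (l w))) (Ξ (Δ (r w))) ⟩
  ⟦ Ξ (Δ (l w)) ⊕ Ξ (Δ (r w)) ⟧            ≡⟨ cong ⟦_⟧ (cong₂ _⊕_ (cong Ξ (Δ-l w)) (cong Ξ (Δ-r w))) ⟩
  ⟦ Ξ (init (Δ w)) ⊕ Ξ (tail (Δ w)) ⟧      ≡⟨ cong ⟦_⟧ (Ξ-split (Δ w) noRun) ⟨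
  ⟦ Ξ (Δ w) ⟧                              ∎
  where
  open ≡-Reasoning
  w = a ∷ t
  noRun : oddRun (Δ w) ≡ false
  noRun with oddRun (Δ w) in run
  ... | false = refl
  ... | true with oddRun-Δ⇒isTeven⊎isCTeven w run
  ...   | inj₁ e = trans (sym e) even
  ...   | inj₂ e = trans (sym e) coeven

Φ-odd-constant : ∀ a w → w ≡ replicate (length w) a → isOdd (length w) ≡ true → Φ w ≡ letter a
Φ-odd-constant a w w≡ odd = begin
  negate^ (suc (length w)) (Ξ (signs 0 w))
    ≡⟨ cong (λ v → negate^ (suc (length w)) (Ξ (signs 0 v))) (trans w≡ (sym (alternate-diag a (length w)))) ⟩
  negate^ (suc (length w)) (Ξ (signs 0 (alternate a a (length w))))
    ≡⟨ cong (λ s → negate^ (suc (length w)) (Ξ s)) (signs-alternate 0 a a (length w)) ⟩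
  negate^ (suc (length w)) (Ξ (zigzag (letter a) (length w)))
    ≡⟨ cong (negate^ (suc (length w))) (Ξ-zigzag (letter a) (length w)) ⟩
  negate^ (suc (length w)) (if isOdd (length w) then letter a else nul)
    ≡⟨ cong (λ b → if not b then negate (if b then letter a else nul) else (if b then letter a else nul)) odd ⟩
  letter a ∎
  where open ≡-Reasoning

isZeroOdd⇒Φ≡neg : ∀ w → isZeroOdd w ≡ true → Φ w ≡ neg
isZeroOdd⇒Φ≡neg w h with ∧≡true⇒ {does (w ≟w replicate (length w) false)} h
... | w≡ , odd = Φ-odd-constant false w (does≡true⇒ (w ≟w replicate (length w) false) w≡) odd

isOneOdd⇒Φ≡pos : ∀ w → isOneOdd w ≡ true → Φ w ≡ pos
isOneOdd⇒Φ≡pos w h with ∧≡true⇒ {does (w ≟w replicate (length w) true)} h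
... | w≡ , odd = Φ-odd-constant true w (does≡true⇒ (w ≟w replicate (length w) true) w≡) odd

oddRun-signs⇒isZeroOdd⊎isOneOdd : ∀ w → oddRun (signs 0 w) ≡ true → isZeroOdd w ≡ true ⊎ isOneOdd w ≡ true
oddRun-signs⇒isZeroOdd⊎isOneOdd (a ∷ t) h with ∧≡true⇒ {isNonzero (letter a)} h
... | _ , h′ with ∧≡true⇒ {alternates (signs 0 (a ∷ t))} h′
... | constant , even = intro a w≡
  where
  w = a ∷ t
  w≡ : w ≡ replicate (length w) a
  w≡ = trans (alternates-signs⇒constant 0 a t constant) (alternate-diag a (length w))
  odd : isOdd (length w) ≡ true
  odd = trans (cong isEven (sym (length-signs 1 t))) even
  intro : ∀ c → w ≡ replicate (length w) c → isZeroOdd w ≡ true ⊎ isOneOdd w ≡ true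
  intro false w≡ rewrite dec-true (w ≟w replicate (length w) false) w≡ | odd = inj₁ refl
  intro true  w≡ rewrite dec-true (w ≟w replicate (length w) true) w≡ | odd = inj₂ refl

negate^-⊖-swap : ∀ m X Y → negate^ (2 + m) (X ⊕ negate Y) ≡ negate^ (suc m) Y ⊕ negate (negate^ (suc m) X)
negate^-⊖-swap m X Y with isOdd m
... | true  = from-yes (∀Sgn? λ X → ∀Sgn? λ Y → negate (X ⊕ negate Y) ≟ₛ Y ⊕ negate X) X Y
... | false = from-yes (∀Sgn? λ X → ∀Sgn? λ Y → X ⊕ negate Y ≟ₛ negate Y ⊕ negate (negate X)) X Y

φ-fuel-Φ : ∀ f w → length w ≤ f → φ-fuel f w ≡ ⟦ Φ w ⟧
φ-fuel-Φ zero    []      _ = refl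
φ-fuel-Φ (suc f) []      _ = refl
φ-fuel-Φ (suc f) (a ∷ t) (s≤s ∣t∣≤) with isZeroOdd (a ∷ t) in zeros | isOneOdd (a ∷ t) in ones
... | true  | _     = cong ⟦_⟧ (sym (isZeroOdd⇒Φ≡neg (a ∷ t) zeros))
... | false | true  = cong ⟦_⟧ (sym (isOneOdd⇒Φ≡pos (a ∷ t) ones))
... | false | false = begin
  sgn (φ-fuel f (r w) +ℤ - φ-fuel f (l w))
    ≡⟨ cong₂ (λ p q → sgn (p +ℤ - q)) (φ-fuel-Φ f t ∣t∣≤) (φ-fuel-Φ f (l w) (subst (_≤ f) (sym (length-l a t)) ∣t∣≤)) ⟩
  sgn (⟦ Φ t ⟧ +ℤ - ⟦ Φ (l w) ⟧)                    ≡⟨ ⟦⊖⟧ (Φ t) (Φ (l w)) ⟩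
  ⟦ Φ t ⊕ negate (Φ (l w)) ⟧                        ≡⟨ cong (λ n → ⟦ Φ t ⊕ negate (negate^ (suc n) X) ⟧) (length-l a t) ⟩
  ⟦ negate^ (suc m) Y ⊕ negate (negate^ (suc m) X) ⟧ ≡⟨ cong ⟦_⟧ (negate^-⊖-swap m X Y) ⟨
  ⟦ negate^ (2 + m) (X ⊕ negate Y) ⟧               ≡⟨ cong (λ s → ⟦ negate^ (2 + m) s ⟧) split ⟨
  ⟦ Φ w ⟧                                          ∎
  where
  open ≡-Reasoning
  w = a ∷ t
  m = length t
  X = Ξ (signs 0 (l w))
  Y = Ξ (signs 0 t)
  noRun : oddRun (signs 0 w) ≡ false
  noRun with oddRun (signs 0 w) in run
  ... | false = refl
  ... | true with oddRun-signs⇒isZeroOdd⊎isOneOdd w run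
  ...   | inj₁ e = trans (sym e) zeros
  ...   | inj₂ e = trans (sym e) ones
  split : Ξ (signs 0 w) ≡ X ⊕ negate Y
  split = trans (Ξ-split (signs 0 w) noRun)
    (cong₂ _⊕_ (cong Ξ (sym (signs-l 0 w))) (trans (cong Ξ (signs-suc 0 t)) (Ξ-negate (signs 0 t))))

ψ≡⟦Ψ⟧ : ∀ w → ψ w ≡ ⟦ Ψ w ⟧
ψ≡⟦Ψ⟧ w = begin
  (ξ w ^ length w) * φ w
    ≡⟨ cong₂ (λ p q → (p ^ length w) * q) (ξ-fuel-Δ (length w) w ≤-refl) (φ-fuel-Φ (length w) w ≤-refl) ⟩
  (⟦ Ξ (Δ w) ⟧ ^ length w) * ⟦ Φ w ⟧          ≡⟨ cong (_* ⟦ Φ w ⟧) (⟦^ₛ⟧ (Ξ (Δ w)) (length w)) ⟨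
  ⟦ Ξ (Δ w) ^ₛ length w ⟧ * ⟦ Φ w ⟧           ≡⟨ ⟦⊗⟧ (Ξ (Δ w) ^ₛ length w) (Φ w) ⟨
  ⟦ Ψ w ⟧                                     ∎
  where open ≡-Reasoning

-- How Ψ changes when a word is extended or a periodic core is shortened

Ψ-cong-length+2 : ∀ n v w → length v ≡ 3 + n → length w ≡ 1 + n →
                  Ξ (Δ v) ≡ Ξ (Δ w) → Ξ (signs 0 v) ≡ Ξ (signs 0 w) → Ψ v ≡ Ψ w
Ψ-cong-length+2 n v w ∣v∣ ∣w∣ δ s = begin
  Ξ (Δ v) ^ₛ length v ⊗ negate^ (suc (length v)) (Ξ (signs 0 v))
    ≡⟨ cong₂ (λ ℓ x → Ξ (Δ v) ^ₛ ℓ ⊗ negate^ (suc ℓ) x) ∣v∣ s ⟩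
  Ξ (Δ v) ^ₛ (3 + n) ⊗ negate^ (4 + n) (Ξ (signs 0 w))
    ≡⟨ cong₂ _⊗_ (trans (cong (_^ₛ (3 + n)) δ) (^ₛ-3+ (Ξ (Δ w)) n)) (negate^-2+ (2 + n) (Ξ (signs 0 w))) ⟩
  Ξ (Δ w) ^ₛ (1 + n) ⊗ negate^ (2 + n) (Ξ (signs 0 w))
    ≡⟨ cong (λ ℓ → Ξ (Δ w) ^ₛ ℓ ⊗ negate^ (suc ℓ) (Ξ (signs 0 w))) ∣w∣ ⟨
  Ξ (Δ w) ^ₛ length w ⊗ negate^ (suc (length w)) (Ξ (signs 0 w)) ∎
  where open ≡-Reasoning

Ψ-extend : ∀ x A y → alternates (Δ A) ≡ false → Ψ (x ∷ A ∷ʳ y) ≡ negate (Ψ A)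
Ψ-extend x (a ∷ A) y h = begin
  Ξ (Δ w) ^ₛ length w ⊗ negate^ (suc (length w)) (Ξ (signs 0 w))
    ≡⟨ cong (λ ℓ → Ξ (Δ w) ^ₛ ℓ ⊗ negate^ (suc ℓ) (Ξ (signs 0 w))) ∣w∣ ⟩
  Ξ (Δ w) ^ₛ (3 + n) ⊗ negate^ (4 + n) (Ξ (signs 0 w))
    ≡⟨ cong₂ (λ d s → d ^ₛ (3 + n) ⊗ negate^ (4 + n) s) ΞΔ Ξsigns ⟩
  Ξ (Δ A′) ^ₛ (3 + n) ⊗ negate^ (4 + n) (negate (Ξ (signs 0 A′)))
    ≡⟨ cong₂ _⊗_ (^ₛ-3+ (Ξ (Δ A′)) n) (trans (negate^-2+ (2 + n) _) (negate^-negate (2 + n) _)) ⟩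
  Ξ (Δ A′) ^ₛ (1 + n) ⊗ negate (negate^ (2 + n) (Ξ (signs 0 A′)))
    ≡⟨ ⊗-negateʳ (Ξ (Δ A′) ^ₛ (1 + n)) _ ⟩
  negate (Ψ A′) ∎
  where
  open ≡-Reasoning
  A′ = a ∷ A
  w = x ∷ A′ ∷ʳ y
  n = length A
  ∣w∣ : length w ≡ 3 + n
  ∣w∣ = cong suc (length-∷ʳ A′ y)
  ΞΔ : Ξ (Δ w) ≡ Ξ (Δ A′)
  ΞΔ = trans (cong (λ s → Ξ (jump x a ∷ s)) (Δ-∷ʳ a A y)) (Ξ-strip (jump x a) (Δ A′) (jump (last a A) y) h)
  signs-nonconstant : alternates (signs 1 A′) ≡ false
  signs-nonconstant = contraposeᵇ (alternates-signs⇒alternates-Δ 1 A′) h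
  Ξsigns : Ξ (signs 0 w) ≡ negate (Ξ (signs 0 A′))
  Ξsigns = begin
    Ξ (letter x ∷ signs 1 (A′ ∷ʳ y))                              ≡⟨ cong (λ s → Ξ (letter x ∷ s)) (signs-∷ʳ 1 A′ y) ⟩
    Ξ (letter x ∷ signs 1 A′ ∷ʳ negate^ (1 + length A′) (letter y)) ≡⟨ Ξ-strip (letter x) (signs 1 A′) _ signs-nonconstant ⟩
    Ξ (signs 1 A′)                                                ≡⟨ cong Ξ (signs-suc 0 A′) ⟩
    Ξ (map negate (signs 0 A′))                                   ≡⟨ Ξ-negate (signs 0 A′) ⟩
    negate (Ξ (signs 0 A′))                                       ∎

length-alternate∷ʳ : {A : Set} (a b : A) (m : ℕ) (y : A) → length (alternate a b m ∷ʳ y) ≡ suc m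
length-alternate∷ʳ a b m y = trans (length-∷ʳ (alternate a b m) y) (cong suc (length-alternate a b m))

Δ-∷alternate∷ʳ : ∀ x a b m y →
  Δ (x ∷ alternate a b (suc m) ∷ʳ y) ≡ jump x a ∷ zigzag (jump a b) m ∷ʳ jump (last a (alternate b a m)) y
Δ-∷alternate∷ʳ x a b m y =
  cong (jump x a ∷_) (trans (Δ-∷ʳ a (alternate b a m) y) (cong (_∷ʳ jump (last a (alternate b a m)) y) (Δ-alternate a b m)))

Δ-alternate∷ʳ∷ʳ : ∀ a b m y₁ y₂ →
  Δ ((alternate a b (suc m) ∷ʳ y₁) ∷ʳ y₂) ≡ (zigzag (jump a b) m ∷ʳ jump (last a (alternate b a m)) y₁) ∷ʳ jump y₁ y₂
Δ-alternate∷ʳ∷ʳ a b m y₁ y₂ = trans (Δ-∷ʳ a (alternate b a m ∷ʳ y₁) y₂)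
  (cong₂ _∷ʳ_ (trans (Δ-∷ʳ a (alternate b a m) y₁) (cong (_∷ʳ jump (last a (alternate b a m)) y₁) (Δ-alternate a b m)))
              (cong (λ z → jump z y₂) (last-∷ʳ a (alternate b a m) y₁)))

signs-alternate∷ʳ : ∀ i a b m y →
  signs i (alternate a b m ∷ʳ y) ≡ alternate (negate^ i (letter a)) (negate^ (suc i) (letter b)) m ∷ʳ negate^ (i + m) (letter y)
signs-alternate∷ʳ i a b m y = trans (signs-∷ʳ i (alternate a b m) y)
  (cong₂ _∷ʳ_ (signs-alternate i a b m) (cong (λ j → negate^ (i + j) (letter y)) (length-alternate a b m)))

Ψ-∷alternate∷ʳ-period : ∀ x a b k y → Ψ (x ∷ alternate a b (5 + k) ∷ʳ y) ≡ Ψ (x ∷ alternate a b (3 + k) ∷ʳ y)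
Ψ-∷alternate∷ʳ-period x a b k y =
  Ψ-cong-length+2 (4 + k) (x ∷ alternate a b (5 + k) ∷ʳ y) (x ∷ alternate a b (3 + k) ∷ʳ y)
    (cong suc (length-alternate∷ʳ a b (5 + k) y)) (cong suc (length-alternate∷ʳ a b (3 + k) y))
    (begin
      Ξ (Δ (x ∷ alternate a b (5 + k) ∷ʳ y))                   ≡⟨ cong Ξ (Δ-∷alternate∷ʳ x a b (4 + k) y) ⟩
      Ξ (jump x a ∷ zigzag (jump a b) (4 + k) ∷ʳ j)            ≡⟨ Ξ-∷zigzag∷ʳ-period (jump x a) (jump a b) (1 + k) j ⟩
      Ξ (jump x a ∷ zigzag (jump a b) (2 + k) ∷ʳ j)            ≡⟨ cong Ξ (Δ-∷alternate∷ʳ x a b (2 + k) y) ⟨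
      Ξ (Δ (x ∷ alternate a b (3 + k) ∷ʳ y))                   ∎)
    (begin
      Ξ (letter x ∷ signs 1 (alternate a b (5 + k) ∷ʳ y))      ≡⟨ cong (λ s → Ξ (letter x ∷ s)) (signs-alternate∷ʳ 1 a b (5 + k) y) ⟩
      Ξ (letter x ∷ alternate α β (5 + k) ∷ʳ negate^ (6 + k) (letter y))
        ≡⟨ cong (λ q → Ξ (letter x ∷ alternate α β (5 + k) ∷ʳ q)) (negate^-2+ (4 + k) (letter y)) ⟩
      Ξ (letter x ∷ alternate α β (5 + k) ∷ʳ negate^ (4 + k) (letter y))
        ≡⟨ Ξ-∷block∷ʳ-period (signs-block 1 a b) (letter x) k (negate^ (4 + k) (letter y)) ⟩
      Ξ (letter x ∷ alternate α β (3 + k) ∷ʳ negate^ (4 + k) (letter y))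
        ≡⟨ cong (λ s → Ξ (letter x ∷ s)) (signs-alternate∷ʳ 1 a b (3 + k) y) ⟨
      Ξ (letter x ∷ signs 1 (alternate a b (3 + k) ∷ʳ y))      ∎)
  where
  open ≡-Reasoning
  j = jump (last a (alternate b a (2 + k))) y
  α = negate^ 1 (letter a)
  β = negate^ 2 (letter b)

Ψ-alternate∷ʳ∷ʳ-period : ∀ a b k y₁ y₂ →
  Ψ ((alternate a b (5 + k) ∷ʳ y₁) ∷ʳ y₂) ≡ Ψ ((alternate a b (3 + k) ∷ʳ y₁) ∷ʳ y₂)
Ψ-alternate∷ʳ∷ʳ-period a b k y₁ y₂ =
  Ψ-cong-length+2 (4 + k) ((alternate a b (5 + k) ∷ʳ y₁) ∷ʳ y₂) ((alternate a b (3 + k) ∷ʳ y₁) ∷ʳ y₂)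
    (∣u∣ (5 + k)) (∣u∣ (3 + k))
    (begin
      Ξ (Δ ((alternate a b (5 + k) ∷ʳ y₁) ∷ʳ y₂))                  ≡⟨ cong Ξ (Δ-alternate∷ʳ∷ʳ a b (4 + k) y₁ y₂) ⟩
      Ξ ((zigzag (jump a b) (4 + k) ∷ʳ j) ∷ʳ jump y₁ y₂)           ≡⟨ Ξ-zigzag∷ʳ∷ʳ-period (jump a b) k j (jump y₁ y₂) ⟩
      Ξ ((zigzag (jump a b) (2 + k) ∷ʳ j) ∷ʳ jump y₁ y₂)           ≡⟨ cong Ξ (Δ-alternate∷ʳ∷ʳ a b (2 + k) y₁ y₂) ⟨
      Ξ (Δ ((alternate a b (3 + k) ∷ʳ y₁) ∷ʳ y₂))                  ∎)
    (begin
      Ξ (signs 0 ((alternate a b (5 + k) ∷ʳ y₁) ∷ʳ y₂))            ≡⟨ cong Ξ (signs-blocks (5 + k)) ⟩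
      Ξ ((alternate α β (5 + k) ∷ʳ q₁ (5 + k)) ∷ʳ q₂ (5 + k))      ≡⟨ cong₂ (λ p q → Ξ ((alternate α β (5 + k) ∷ʳ p) ∷ʳ q))
                                                                        (negate^-2+ (3 + k) (letter y₁)) (negate^-2+ (4 + k) (letter y₂)) ⟩
      Ξ ((alternate α β (5 + k) ∷ʳ q₁ (3 + k)) ∷ʳ q₂ (3 + k))      ≡⟨ Ξ-block∷ʳ∷ʳ-period (signs-block 0 a b) k _ _ ⟩
      Ξ ((alternate α β (3 + k) ∷ʳ q₁ (3 + k)) ∷ʳ q₂ (3 + k))      ≡⟨ cong Ξ (signs-blocks (3 + k)) ⟨
      Ξ (signs 0 ((alternate a b (3 + k) ∷ʳ y₁) ∷ʳ y₂))            ∎)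
  where
  open ≡-Reasoning
  j = jump (last a (alternate b a (2 + k))) y₁
  α = negate^ 0 (letter a)
  β = negate^ 1 (letter b)
  q₁ q₂ : ℕ → Sgn
  q₁ m = negate^ m (letter y₁)
  q₂ m = negate^ (suc m) (letter y₂)
  ∣u∣ : ∀ m → length ((alternate a b m ∷ʳ y₁) ∷ʳ y₂) ≡ 2 + m
  ∣u∣ m = trans (length-∷ʳ (alternate a b m ∷ʳ y₁) y₂) (cong suc (length-alternate∷ʳ a b m y₁))
  signs-blocks : ∀ m → signs 0 ((alternate a b m ∷ʳ y₁) ∷ʳ y₂) ≡ (alternate α β m ∷ʳ q₁ m) ∷ʳ q₂ m
  signs-blocks m = trans (signs-∷ʳ 0 (alternate a b m ∷ʳ y₁) y₂)
    (cong₂ _∷ʳ_ (signs-alternate∷ʳ 0 a b m y₁) (cong (λ ℓ → negate^ ℓ (letter y₂)) (length-alternate∷ʳ a b m y₁)))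

Ψ-∷∷alternate-period : ∀ x₁ x₂ a b k → Ψ (x₁ ∷ x₂ ∷ alternate a b (5 + k)) ≡ Ψ (x₁ ∷ x₂ ∷ alternate a b (3 + k))
Ψ-∷∷alternate-period x₁ x₂ a b k =
  Ψ-cong-length+2 (4 + k) (x₁ ∷ x₂ ∷ alternate a b (5 + k)) (x₁ ∷ x₂ ∷ alternate a b (3 + k))
    (cong (2 +_) (length-alternate a b (5 + k))) (cong (2 +_) (length-alternate a b (3 + k)))
    (begin
      Ξ (Δ (x₁ ∷ x₂ ∷ alternate a b (5 + k)))            ≡⟨ cong (λ s → Ξ (j₁ ∷ j₂ ∷ s)) (Δ-alternate a b (4 + k)) ⟩
      Ξ (j₁ ∷ j₂ ∷ zigzag (jump a b) (4 + k))            ≡⟨ Ξ-∷∷zigzag-period j₁ j₂ (jump a b) k ⟩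
      Ξ (j₁ ∷ j₂ ∷ zigzag (jump a b) (2 + k))            ≡⟨ cong (λ s → Ξ (j₁ ∷ j₂ ∷ s)) (Δ-alternate a b (2 + k)) ⟨
      Ξ (Δ (x₁ ∷ x₂ ∷ alternate a b (3 + k)))            ∎)
    (begin
      Ξ (s₁ ∷ s₂ ∷ signs 2 (alternate a b (5 + k)))      ≡⟨ cong (λ s → Ξ (s₁ ∷ s₂ ∷ s)) (signs-alternate 2 a b (5 + k)) ⟩
      Ξ (s₁ ∷ s₂ ∷ alternate α β (5 + k))                ≡⟨ Ξ-∷∷block-period (signs-block 2 a b) s₁ s₂ k ⟩
      Ξ (s₁ ∷ s₂ ∷ alternate α β (3 + k))                ≡⟨ cong (λ s → Ξ (s₁ ∷ s₂ ∷ s)) (signs-alternate 2 a b (3 + k)) ⟨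
      Ξ (s₁ ∷ s₂ ∷ signs 2 (alternate a b (3 + k)))      ∎)
  where
  open ≡-Reasoning
  j₁ = jump x₁ x₂
  j₂ = jump x₂ a
  s₁ = letter x₁
  s₂ = negate^ 1 (letter x₂)
  α = negate^ 2 (letter a)
  β = negate^ 3 (letter b)

-- Consecutive windows

Opposite : Sgn → Sgn → Set
Opposite p q = ¬ p ≡ nul → ¬ q ≡ nul → q ≡ negate p

opposite? : ∀ p q → Dec (Opposite p q)
opposite? p q = ¬? (p ≟ₛ nul) →-dec ¬? (q ≟ₛ nul) →-dec q ≟ₛ negate p

Opposite-negate : ∀ {p q} → Opposite p q → Opposite (negate p) (negate q)
Opposite-negate {p} {q} opp p≢0 q≢0 =
  cong negate (opp (λ p≡0 → p≢0 (cong negate p≡0)) (λ q≡0 → q≢0 (cong negate q≡0)))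

∀Word? : {P : Word → Set} → (∀ w → Dec (P w)) → ∀ n → Dec (∀ w → length w ≡ n → P w)
∀Word? P? zero    = map′ (λ { p [] _ → p }) (λ f → f [] refl) (P? [])
∀Word? P? (suc n) = map′
  (λ { (f , t) (false ∷ w) e → f w (suc-injective e) ; (f , t) (true ∷ w) e → t w (suc-injective e) })
  (λ g → (λ w e → g (false ∷ w) (cong suc e)) , (λ w e → g (true ∷ w) (cong suc e)))
  (∀Word? (λ w → P? (false ∷ w)) n ×-dec ∀Word? (λ w → P? (true ∷ w)) n)

WindowsOpposite : ℕ → Set
WindowsOpposite m = ∀ x y M → length M ≡ suc m → Opposite (Ψ (x ∷ M)) (Ψ (M ∷ʳ y))

windows-opposite? : ∀ m → Dec (WindowsOpposite m)
windows-opposite? m = ∀Bool? λ x → ∀Bool? λ y → ∀Word? (λ M → opposite? (Ψ (x ∷ M)) (Ψ (M ∷ʳ y))) (suc m)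

windows-opposite-step : ∀ k → WindowsOpposite (3 + k) → ∀ x y m₀ N ℓ → length N ≡ 4 + k →
                        Opposite (Ψ (x ∷ m₀ ∷ N ∷ʳ ℓ)) (Ψ ((m₀ ∷ N ∷ʳ ℓ) ∷ʳ y))
windows-opposite-step k ih x y m₀ N ℓ ∣N∣ =
  cases (alternates (Δ (m₀ ∷ N))) refl (alternates (Δ (N ∷ʳ ℓ))) refl
  where
  cases : ∀ p → alternates (Δ (m₀ ∷ N)) ≡ p → ∀ q → alternates (Δ (N ∷ʳ ℓ)) ≡ q →
          Opposite (Ψ (x ∷ m₀ ∷ N ∷ʳ ℓ)) (Ψ ((m₀ ∷ N ∷ʳ ℓ) ∷ʳ y))
  cases true initPeriodic _ _ with alternates-Δ⇒alternate (m₀ ∷ N) initPeriodic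
  ... | a , b , A≡ = subst (λ A → Opposite (Ψ (x ∷ A ∷ʳ ℓ)) (Ψ ((A ∷ʳ ℓ) ∷ʳ y))) (sym A₅≡) shortened
    where
    A₅≡ : m₀ ∷ N ≡ alternate a b (5 + k)
    A₅≡ = trans A≡ (cong (λ n → alternate a b (suc n)) ∣N∣)
    shortened : Opposite (Ψ (x ∷ alternate a b (5 + k) ∷ʳ ℓ)) (Ψ ((alternate a b (5 + k) ∷ʳ ℓ) ∷ʳ y))
    shortened = subst₂ Opposite (sym (Ψ-∷alternate∷ʳ-period x a b k ℓ)) (sym (Ψ-alternate∷ʳ∷ʳ-period a b k ℓ y))
      (ih x y (alternate a b (3 + k) ∷ʳ ℓ) (length-alternate∷ʳ a b (3 + k) ℓ))
  cases false _ true tailPeriodic with alternates-Δ⇒alternate (N ∷ʳ ℓ) tailPeriodic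
  ... | a , b , A≡ = subst (λ A → Opposite (Ψ (x ∷ m₀ ∷ A)) (Ψ (m₀ ∷ A ∷ʳ y))) (sym A₅≡) shortened
    where
    A₅≡ : N ∷ʳ ℓ ≡ alternate a b (5 + k)
    A₅≡ = trans A≡ (cong (alternate a b) (trans (length-∷ʳ N ℓ) (cong suc ∣N∣)))
    shortened : Opposite (Ψ (x ∷ m₀ ∷ alternate a b (5 + k))) (Ψ (m₀ ∷ alternate a b (5 + k) ∷ʳ y))
    shortened = subst₂ Opposite (sym (Ψ-∷∷alternate-period x m₀ a b k)) (sym (Ψ-∷alternate∷ʳ-period m₀ a b k y))
      (ih x y (m₀ ∷ alternate a b (3 + k)) (cong suc (length-alternate a b (3 + k))))
  cases false initAperiodic false tailAperiodic =
    subst₂ Opposite (sym (Ψ-extend x (m₀ ∷ N) ℓ initAperiodic)) (sym (Ψ-extend m₀ (N ∷ʳ ℓ) y tailAperiodic))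
      (Opposite-negate (ih m₀ ℓ N ∣N∣))

-- A core can be shortened by two once it has length at least 5.
windows-opposite : ∀ m → WindowsOpposite m
windows-opposite 0 = from-yes (windows-opposite? 0)
windows-opposite 1 = from-yes (windows-opposite? 1)
windows-opposite 2 = from-yes (windows-opposite? 2)
windows-opposite 3 = from-yes (windows-opposite? 3)
windows-opposite 4 = from-yes (windows-opposite? 4)
windows-opposite (suc (suc (suc (suc (suc k))))) x y (m₀ ∷ n₀ ∷ M) ∣M∣ =
  subst (λ M → Opposite (Ψ (x ∷ M)) (Ψ (M ∷ʳ y))) (sym (cong (m₀ ∷_) (∷-init-last n₀ M)))
    (windows-opposite-step k (windows-opposite (suc (suc (suc k)))) x y m₀ (init (n₀ ∷ M)) (last n₀ M)
      (trans (length-init n₀ M) (suc-injective (suc-injective ∣M∣))))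

ψ-windows-opposite : ∀ x M y → ¬ ψ (x ∷ M) ≡ 0ℤ → ¬ ψ (M ∷ʳ y) ≡ 0ℤ → ψ (M ∷ʳ y) ≡ - ψ (x ∷ M)
ψ-windows-opposite false []       y ψu≢0 _ = ⊥-elim (ψu≢0 refl)
ψ-windows-opposite true  []       y ψu≢0 _ = ⊥-elim (ψu≢0 refl)
ψ-windows-opposite x     (m₀ ∷ M) y ψu≢0 ψv≢0 = begin
  ψ v                 ≡⟨ ψ≡⟦Ψ⟧ v ⟩
  ⟦ Ψ v ⟧             ≡⟨ cong ⟦_⟧ (windows-opposite (length M) x y (m₀ ∷ M) refl (nonzero u ψu≢0) (nonzero v ψv≢0)) ⟩
  ⟦ negate (Ψ u) ⟧    ≡⟨ ⟦negate⟧ (Ψ u) ⟩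
  - ⟦ Ψ u ⟧           ≡⟨ cong -_ (ψ≡⟦Ψ⟧ u) ⟨
  - ψ u               ∎
  where
  open ≡-Reasoning
  u = x ∷ m₀ ∷ M
  v = (m₀ ∷ M) ∷ʳ y
  nonzero : ∀ w → ¬ ψ w ≡ 0ℤ → ¬ Ψ w ≡ nul
  nonzero w ψ≢0 Ψ≡nul = ψ≢0 (trans (ψ≡⟦Ψ⟧ w) (cong ⟦_⟧ Ψ≡nul))

applyUpTo-cong : {A : Set} {f g : ℕ → A} → (∀ i → f i ≡ g i) → ∀ n → applyUpTo f n ≡ applyUpTo g n
applyUpTo-cong f≗g zero    = refl
applyUpTo-cong f≗g (suc n) = cong₂ _∷_ (f≗g 0) (applyUpTo-cong (f≗g ∘ suc) n)

factor-suc : ∀ w k n → factor w k (suc n) ≡ w k ∷ factor w (suc k) n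
factor-suc w k n = cong₂ _∷_ (cong w (+-identityʳ k)) (begin
  map (λ i → w (k + i)) (applyUpTo suc n)  ≡⟨ map-applyUpTo suc (λ i → w (k + i)) n ⟩
  applyUpTo (λ i → w (k + suc i)) n        ≡⟨ applyUpTo-cong (λ i → cong w (+-suc k i)) n ⟩
  applyUpTo (λ i → w (suc k + i)) n        ≡⟨ map-upTo (λ i → w (suc k + i)) n ⟨
  factor w (suc k) n                       ∎)
  where open ≡-Reasoning

factor-∷ʳ : ∀ w k n → factor w k (suc n) ≡ factor w k n ∷ʳ w (k + n)
factor-∷ʳ w k n = begin
  factor w k (suc n)                            ≡⟨ map-upTo (λ i → w (k + i)) (suc n) ⟩
  applyUpTo (λ i → w (k + i)) (suc n)           ≡⟨ applyUpTo-∷ʳ (λ i → w (k + i)) n ⟨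
  applyUpTo (λ i → w (k + i)) n ∷ʳ w (k + n)    ≡⟨ cong (_∷ʳ w (k + n)) (map-upTo (λ i → w (k + i)) n) ⟨
  factor w k n ∷ʳ w (k + n)                     ∎
  where open ≡-Reasoning

ψ-consecutive-factors : ∀ w k n → ¬ ψ (factor w k (suc n)) ≡ 0ℤ → ¬ ψ (factor w (suc k) (suc n)) ≡ 0ℤ →
                        ψ (factor w (suc k) (suc n)) ≡ - ψ (factor w k (suc n))
ψ-consecutive-factors w k n =
  subst₂ (λ u v → ¬ ψ u ≡ 0ℤ → ¬ ψ v ≡ 0ℤ → ψ v ≡ - ψ u) (sym (factor-suc w k n)) (sym (factor-∷ʳ w (suc k) n))
    (ψ-windows-opposite (w k) (factor w (suc k) n) (w (suc k + n)))

corollary5p9 : (n : ℕ) → 2 ≤ n → (X : Seq → Set) → IsColourableShift n X →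
               (w : Seq) → X w → (k : ℕ) →
               ψ (factor w k n) ≡ (-1ℤ ^ k) * ψ (factor w 0 n)
corollary5p9 (suc n) _ _ (_ , maximal) w Xw = go
  where
  open ≡-Reasoning
  go : ∀ k → ψ (factor w k (suc n)) ≡ (-1ℤ ^ k) * ψ (factor w 0 (suc n))
  go zero    = sym (*-identityˡ _)
  go (suc k) = begin
    ψ (factor w (suc k) (suc n))               ≡⟨ ψ-consecutive-factors w k n (maximal w Xw k) (maximal w Xw (suc k)) ⟩
    - ψ (factor w k (suc n))                   ≡⟨ cong -_ (go k) ⟩
    - ((-1ℤ ^ k) * ψ (factor w 0 (suc n)))     ≡⟨ -1*i≡-i _ ⟨
    -1ℤ * ((-1ℤ ^ k) * ψ (factor w 0 (suc n))) ≡⟨ *-assoc -1ℤ (-1ℤ ^ k) _ ⟨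
    (-1ℤ ^ suc k) * ψ (factor w 0 (suc n))     ∎
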